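{- Let $\alpha\vdash k$. Then for all integers $n\geq 0$, $$ N(n+k;\alpha)= \sum_{j=0}^k \binom{n}{j}\left( \sum_{\mu\vdash k-j} f^{\alpha/\mu}\right) t_{n-j}. $$
   Context: A standard Young tableau (SYT) of (possibly skew) shape is a filling of the cells of the diagram by $1,2,\dots$ (each once) increasing along rows and down columns. For a partition $\alpha\vdash k$ and a fixed SYT $T$ of shape $\alpha$, $N(m;\alpha)$ denotes the number of SYT with $m$ cells that contain $T$ as a subtableau (i.e. whose entries $1,\dots,k$ form exactly $T$); equivalently $N(m;\alpha)=\sum_{\lambda\vdash m} f^{\lambda/\alpha}$, where $f^{\lambda/\mu}$ is the number of SYT of skew shape $\lambda/\mu$ (taken to be $0$ if $\mu\not\subseteq\lambda$, and $1$ if $\lambda=\mu$). $t_m$ denotes the number of involutions in the symmetric group $\mathfrak{S}_m$ (with $t_0=1$); terms with $j>n$ vanish because of the binomial coefficient. -}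

module Defs where

open import Data.Bool using (Bool; true; false; _∧_; if_then_else_; not)
open import Data.Nat using (ℕ; zero; suc; _+_; _*_; _∸_; _≤_; _<_; _≡ᵇ_; _<ᵇ_; _≤ᵇ_)
open import Data.Nat.Combinatorics using (_C_)
open import Data.List using (List; []; _∷_; [_]; _++_; map; length; concatMap; upTo; filter; allFin)
open import Data.Nat.ListAction using (sum)
open import Data.List.Relation.Unary.All using (All)
open import Data.List.Relation.Unary.Linked using (Linked)
open import Data.Vec using (Vec; lookup) renaming ([] to []ᵛ; _∷_ to _∷ᵛ_)
open import Data.Fin using (Fin)
import Data.Fin.Properties as FinP
open import Data.Product using (_×_)
open import Relation.Binary.PropositionalEquality using (_≡_)

-- Partitions: lists of positive integers in weakly decreasing order.
-- (α ⊢ k  means  IsPartition α  and  sum α ≡ k.)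

IsPartition : List ℕ → Set
IsPartition α = Linked (λ a b → b ≤ a) α × All (λ a → 0 < a) α

eqList : List ℕ → List ℕ → Bool
eqList [] [] = true
eqList [] (_ ∷ _) = false
eqList (_ ∷ _) [] = false
eqList (a ∷ as) (b ∷ bs) = (a ≡ᵇ b) ∧ eqList as bs

-- Containment of Young diagrams μ ⊆ λ (for partitions with positive parts).
contained : List ℕ → List ℕ → Bool
contained [] _ = true
contained (_ ∷ _) [] = false
contained (a ∷ as) (b ∷ bs) = (a ≤ᵇ b) ∧ contained as bs

-- All partitions obtained from λ by removing one corner cell.
removeCorner : List ℕ → List (List ℕ)
removeCorner [] = []
removeCorner (a ∷ []) = if a ≡ᵇ 1 then [ [] ] else [ (a ∸ 1) ∷ [] ]
removeCorner (a ∷ b ∷ rest) =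
  (if b <ᵇ a then [ (a ∸ 1) ∷ b ∷ rest ] else [])
  ++ map (a ∷_) (removeCorner (b ∷ rest))

-- Number of SYT of skew shape λ/μ, counted as the number of saturated
-- chains μ = λ⁰ ⊂ λ¹ ⊂ … ⊂ λʳ = λ (each step adds one cell, the cell
-- holding entry i being λⁱ/λⁱ⁻¹), enumerated by removing the cell with
-- the largest entry.  Fuel bounds the number of steps (|λ| suffices).
skewFuel : ℕ → List ℕ → List ℕ → ℕ
skewFuel fuel lam mu with eqList lam mu
... | true = 1
... | false with contained mu lam
...   | false = 0
...   | true with fuel
...     | zero = 0
...     | suc f = sum (map (λ nu → skewFuel f nu mu) (removeCorner lam))

-- f^{λ/μ}  (0 if μ ⊄ λ, 1 if λ = μ)
f^ : List ℕ → List ℕ → ℕ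
f^ lam mu = skewFuel (sum lam) lam mu

-- Partitions of m with all parts ≤ p (fuel ≥ m suffices).
partsFuel : ℕ → ℕ → ℕ → List (List ℕ)
partsFuel _ zero _ = [ [] ]
partsFuel zero (suc _) _ = []
partsFuel (suc f) (suc m) p =
  concatMap (λ a → map (suc a ∷_) (partsFuel f (m ∸ a) (suc a)))
            (filter (λ a → suc a Data.Nat.≤? p) (upTo (suc m)))

partitionsOf : ℕ → List (List ℕ)
partitionsOf m = partsFuel m m m

N : ℕ → List ℕ → ℕ
N m α = sum (map (λ lam → f^ lam α) (partitionsOf m))

-- Involutions: t_m = number of σ : Fin m → Fin m with σ ∘ σ = id
-- (such maps are automatically permutations).  Maps are encoded as
-- vectors of their values.

allMaps : (k m : ℕ) → List (Vec (Fin m) k)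
allMaps zero m = [ []ᵛ ]
allMaps (suc k) m = concatMap (λ i → map (i ∷ᵛ_) (allMaps k m)) (allFin m)

isInvolution : {m : ℕ} → Vec (Fin m) m → Set
isInvolution {m} v = (i : Fin m) → lookup v (lookup v i) ≡ i

t : ℕ → ℕ
t m = length (filter (λ v → FinP.all? (λ i → lookup v (lookup v i) FinP.≟ i))
                     (allMaps m m))

sumTo : ℕ → (ℕ → ℕ) → ℕ
sumTo k g = sum (map g (upTo (suc k)))

module Submission where

-- Young's lattice is a differential poset.  For g on partitions put up g λ = Σ_{ν ⋗ λ} g ν.
-- Deleting the largest entry of a standard tableau gives Σ_{λ ⊢ m+n} f^{λ/μ} g λ = upⁿ g μ,
-- so N(n+k; α) = upⁿ 1 α.  Let dⱼ λ be the number of ways to remove j cells from λ one at a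
-- time; then dⱼ α = Σ_{μ ⊢ k−j} f^{α/μ}.  The commutation relation DU = UD + I gives
-- up dⱼ = dⱼ₊₁ + dⱼ + j dⱼ₋₁, and the coefficients C(n,j) t_{n−j} obey the matching recurrence
-- (Pascal's rule and t_{m+1} = t_m + m t_{m−1}), so upⁿ 1 = Σⱼ C(n,j) t_{n−j} dⱼ.
-- The recurrence for t follows by counting the involutions supported in a set S according
-- to the image of a fixed element of S; that count depends only on |S|.

open import Defs
open import Data.Bool using (Bool; true; false; not; _∧_; if_then_else_)
open import Data.Bool.Properties using (if-eta; if-cong; if-cong-then)
import Data.Bool.Properties as Bool
open import Data.Empty using (⊥-elim)
open import Data.Fin using (Fin; zero; suc)
import Data.Fin.Properties as Fin
open import Data.List using (List; []; _∷_; [_]; _++_; map; concatMap; filter; length; applyUpTo; upTo; allFin)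
open import Data.List.Properties
  using (map-++; map-∘; map-cong; map-cong-local; map-tabulate; length-tabulate; ≡-dec)
open import Data.List.Relation.Binary.Prefix.Heterogeneous using (Prefix; []; _∷_)
import Data.List.Relation.Binary.Prefix.Heterogeneous.Properties as Prefixₚ
open import Data.List.Relation.Unary.All using (All; []; _∷_)
import Data.List.Relation.Unary.All as All
import Data.List.Relation.Unary.All.Properties as Allₚ
open import Data.List.Relation.Unary.Linked using ([]; [-]; _∷_)
open import Data.Nat using (ℕ; zero; suc; _+_; _*_; _∸_; _≤_; _<_; z≤n; s≤s; pred; _≡ᵇ_; _<ᵇ_; _≤ᵇ_)
open import Data.Nat.Combinatorics using (_C_; k>n⇒nCk≡0; nCk+nC[k+1]≡[n+1]C[k+1]; nC1≡n)
open import Data.Nat.ListAction using (sum)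
open import Data.Nat.ListAction.Properties using (sum-++)
open import Data.Nat.Properties
open import Data.Nat.Solver using (module +-*-Solver)
open import Data.Product using (_×_; _,_; proj₁; ∃)
open import Data.Sum using (_⊎_; inj₁; inj₂; reduce)
open import Data.Unit using (⊤; tt)
open import Data.Vec using (Vec; lookup; _[_]≔_) renaming ([] to []ᵛ; _∷_ to _∷ᵛ_)
import Data.Vec.Properties as Vec
open import Function using (_∘_; id)
open import Function.Bundles using (_⇔_; mk⇔)
open import Relation.Binary.Definitions using (DecidableEquality)
open import Relation.Binary.PropositionalEquality hiding ([_])
open import Relation.Nullary using (Dec; yes; no; does; ¬_; contradiction)
open import Relation.Nullary.Decidable using (does-⇔; dec-true; dec-false; _×-dec_; _→-dec_)
open import Relation.Nullary.Reflects using (ofʸ; ofⁿ)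
open import Relation.Unary using (Decidable)

open +-*-Solver using (solve; _:+_; _:*_; _:=_; con)

-- Sums

𝟙 : Bool → ℕ
𝟙 b = if b then 1 else 0

𝟙-∧ : ∀ x y → 𝟙 (x ∧ y) ≡ 𝟙 x * 𝟙 y
𝟙-∧ true y = sym (+-identityʳ (𝟙 y))
𝟙-∧ false y = refl

∑ : {A : Set} → List A → (A → ℕ) → ℕ
∑ xs f = sum (map f xs)

syntax ∑ xs (λ x → e) = ∑[ x ← xs ] e

module _ {A : Set} where

  ∑-++ : (xs ys : List A) (f : A → ℕ) → ∑ (xs ++ ys) f ≡ ∑ xs f + ∑ ys f
  ∑-++ xs ys f = trans (cong sum (map-++ f xs ys)) (sum-++ (map f xs) (map f ys))

  ∑-cong : {f g : A → ℕ} → f ≗ g → (xs : List A) → ∑ xs f ≡ ∑ xs g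
  ∑-cong f≗g xs = cong sum (map-cong f≗g xs)

  ∑-congᴬ : {f g : A → ℕ} {xs : List A} → All (λ x → f x ≡ g x) xs → ∑ xs f ≡ ∑ xs g
  ∑-congᴬ eqs = cong sum (map-cong-local eqs)

  ∑-zero : (xs : List A) → ∑[ x ← xs ] 0 ≡ 0
  ∑-zero [] = refl
  ∑-zero (_ ∷ xs) = ∑-zero xs

  ∑-zeroᴬ : {f : A → ℕ} {xs : List A} → All (λ x → f x ≡ 0) xs → ∑ xs f ≡ 0
  ∑-zeroᴬ {xs = xs} zeros = trans (∑-congᴬ zeros) (∑-zero xs)

  ∑-+ : (xs : List A) (f g : A → ℕ) → ∑[ x ← xs ] (f x + g x) ≡ ∑ xs f + ∑ xs g
  ∑-+ [] f g = refl
  ∑-+ (x ∷ xs) f g rewrite ∑-+ xs f g =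
    solve 4 (λ a b c d → (a :+ b) :+ (c :+ d) := (a :+ c) :+ (b :+ d)) refl (f x) (g x) (∑ xs f) (∑ xs g)

  ∑-*ˡ : (c : ℕ) (xs : List A) (f : A → ℕ) → ∑[ x ← xs ] (c * f x) ≡ c * ∑ xs f
  ∑-*ˡ c [] f = sym (*-zeroʳ c)
  ∑-*ˡ c (x ∷ xs) f = trans (cong (c * f x +_) (∑-*ˡ c xs f)) (sym (*-distribˡ-+ c (f x) (∑ xs f)))

  ∑-*ʳ : (c : ℕ) (xs : List A) (f : A → ℕ) → ∑[ x ← xs ] (f x * c) ≡ ∑ xs f * c
  ∑-*ʳ c xs f = begin
    ∑[ x ← xs ] (f x * c) ≡⟨ ∑-cong (λ x → *-comm (f x) c) xs ⟩
    ∑[ x ← xs ] (c * f x) ≡⟨ ∑-*ˡ c xs f ⟩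
    c * ∑ xs f            ≡⟨ *-comm c (∑ xs f) ⟩
    ∑ xs f * c            ∎
    where open ≡-Reasoning

  ∑-1≡length : (xs : List A) → ∑[ x ← xs ] 1 ≡ length xs
  ∑-1≡length [] = refl
  ∑-1≡length (_ ∷ xs) = cong suc (∑-1≡length xs)

  ∑-if : (b : Bool) (xs : List A) (f : A → ℕ) →
         ∑[ x ← xs ] (if b then f x else 0) ≡ (if b then ∑ xs f else 0)
  ∑-if true xs f = refl
  ∑-if false xs f = ∑-zero xs

  ∑-if-[_] : (b : Bool) (x : A) (f : A → ℕ) → ∑ (if b then [ x ] else []) f ≡ (if b then f x else 0)
  ∑-if-[ true ] x f = +-identityʳ (f x)
  ∑-if-[ false ] x f = refl

  ∑-length-filter : {P : A → Set} (P? : Decidable P) (xs : List A) →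
                    length (filter P? xs) ≡ ∑[ x ← xs ] 𝟙 (does (P? x))
  ∑-length-filter P? [] = refl
  ∑-length-filter P? (x ∷ xs) with does (P? x)
  ... | true = cong suc (∑-length-filter P? xs)
  ... | false = ∑-length-filter P? xs

module _ {A B : Set} where

  ∑-map : (g : A → B) (xs : List A) (f : B → ℕ) → ∑ (map g xs) f ≡ ∑ xs (f ∘ g)
  ∑-map g xs f = cong sum (sym (map-∘ xs))

  ∑-concatMap : (g : A → List B) (xs : List A) (f : B → ℕ) →
                ∑ (concatMap g xs) f ≡ ∑[ x ← xs ] ∑ (g x) f
  ∑-concatMap g [] f = refl
  ∑-concatMap g (x ∷ xs) f =
    trans (∑-++ (g x) (concatMap g xs) f) (cong (∑ (g x) f +_) (∑-concatMap g xs f))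

  ∑-swap : (xs : List A) (ys : List B) (F : A → B → ℕ) →
           ∑[ x ← xs ] ∑[ y ← ys ] F x y ≡ ∑[ y ← ys ] ∑[ x ← xs ] F x y
  ∑-swap [] ys F = sym (∑-zero ys)
  ∑-swap (x ∷ xs) ys F = trans (cong (∑ ys (F x) +_) (∑-swap xs ys F))
                               (sym (∑-+ ys (F x) (λ y → ∑[ x′ ← xs ] F x′ y)))

∑< : ℕ → (ℕ → ℕ) → ℕ
∑< zero f = 0
∑< (suc n) f = f 0 + ∑< n (f ∘ suc)

syntax ∑< n (λ j → e) = ∑[ j < n ] e

∑-applyUpTo : (g : ℕ → ℕ) (n : ℕ) (f : ℕ → ℕ) → ∑ (applyUpTo g n) f ≡ ∑< n (f ∘ g)
∑-applyUpTo g zero f = refl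
∑-applyUpTo g (suc n) f = cong (f (g 0) +_) (∑-applyUpTo (g ∘ suc) n f)

∑<-cong : (n : ℕ) {f g : ℕ → ℕ} → (∀ {j} → j < n → f j ≡ g j) → ∑< n f ≡ ∑< n g
∑<-cong zero eq = refl
∑<-cong (suc n) eq = cong₂ _+_ (eq (s≤s z≤n)) (∑<-cong n (λ j<n → eq (s≤s j<n)))

∑<-zero : (n : ℕ) {f : ℕ → ℕ} → (∀ j → f j ≡ 0) → ∑< n f ≡ 0
∑<-zero zero zeros = refl
∑<-zero (suc n) zeros rewrite zeros 0 = ∑<-zero n (zeros ∘ suc)

∑<-+ : (n : ℕ) (f g : ℕ → ℕ) → ∑[ j < n ] (f j + g j) ≡ ∑< n f + ∑< n g
∑<-+ zero f g = refl
∑<-+ (suc n) f g rewrite ∑<-+ n (f ∘ suc) (g ∘ suc) =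
  solve 4 (λ a b c d → (a :+ b) :+ (c :+ d) := (a :+ c) :+ (b :+ d)) refl
          (f 0) (g 0) (∑< n (f ∘ suc)) (∑< n (g ∘ suc))

∑-∑< : {A : Set} (xs : List A) (n : ℕ) (F : A → ℕ → ℕ) →
       ∑[ x ← xs ] ∑< n (F x) ≡ ∑[ j < n ] ∑[ x ← xs ] F x j
∑-∑< [] n F = sym (∑<-zero n (λ _ → refl))
∑-∑< (x ∷ xs) n F =
  trans (cong (∑< n (F x) +_) (∑-∑< xs n F)) (sym (∑<-+ n (F x) (λ j → ∑[ x′ ← xs ] F x′ j)))

∑<-extend : (n n′ : ℕ) {f : ℕ → ℕ} → n ≤ n′ → (∀ {j} → n ≤ j → f j ≡ 0) → ∑< n′ f ≡ ∑< n f
∑<-extend zero n′ _ zeros = ∑<-zero n′ (λ j → zeros z≤n)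
∑<-extend (suc n) (suc n′) (s≤s n≤n′) zeros =
  cong (_ +_) (∑<-extend n n′ n≤n′ (λ n≤j → zeros (s≤s n≤j)))

∑<-resize : (n n′ : ℕ) {f : ℕ → ℕ} → (∀ {j} → n ≤ j → f j ≡ 0) → (∀ {j} → n′ ≤ j → f j ≡ 0) →
            ∑< n f ≡ ∑< n′ f
∑<-resize n n′ zeros zeros′ =
  trans (sym (∑<-extend n (n + n′) (m≤m+n n n′) zeros)) (∑<-extend n′ (n + n′) (m≤n+m n′ n) zeros′)

-- Counting by multiplicities

𝟙-yes : {P : Set} (P? : Dec P) → P → 𝟙 (does P?) ≡ 1
𝟙-yes P? p = cong 𝟙 (dec-true P? p)

𝟙-no : {P : Set} (P? : Dec P) → ¬ P → 𝟙 (does P?) ≡ 0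
𝟙-no P? ¬p = cong 𝟙 (dec-false P? ¬p)

𝟙-× : {P Q : Set} (P? : Dec P) (Q? : Dec Q) → 𝟙 (does P?) * 𝟙 (does Q?) ≡ 𝟙 (does (P? ×-dec Q?))
𝟙-× P? Q? = sym (𝟙-∧ (does P?) (does Q?))

𝟙-⇔ : {P Q : Set} → P ⇔ Q → (P? : Dec P) (Q? : Dec Q) → 𝟙 (does P?) ≡ 𝟙 (does Q?)
𝟙-⇔ P⇔Q P? Q? = cong 𝟙 (does-⇔ P⇔Q P? Q?)

module Counting {A : Set} (_≟_ : DecidableEquality A) where

  δ : A → A → ℕ
  δ x y = 𝟙 (does (x ≟ y))

  δ-refl : ∀ x → δ x x ≡ 1
  δ-refl x = 𝟙-yes (x ≟ x) refl

  δ-sym : ∀ x y → δ x y ≡ δ y x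
  δ-sym x y = 𝟙-⇔ (mk⇔ sym sym) (x ≟ y) (y ≟ x)

  δ-subst : (F : A → ℕ) (x y : A) → δ y x * F y ≡ δ y x * F x
  δ-subst F x y with y ≟ x
  ... | yes refl = refl
  ... | no _ = refl

  multiplicity : List A → A → ℕ
  multiplicity xs x = ∑[ y ← xs ] δ y x

  Enumerates : List A → (A → Set) → Set
  Enumerates xs P = ∀ {x} → P x → multiplicity xs x ≡ 1

  multiplicity-filter : {Q : A → Set} (Q? : Decidable Q) (xs : List A) {x : A} → Q x →
                        multiplicity (filter Q? xs) x ≡ multiplicity xs x
  multiplicity-filter Q? [] qx = refl
  multiplicity-filter Q? (y ∷ xs) {x} qx with Q? y
  ... | yes _ = cong (δ y x +_) (multiplicity-filter Q? xs qx)
  ... | no ¬qy = trans (multiplicity-filter Q? xs qx)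
                       (cong (_+ multiplicity xs x) (sym (𝟙-no (y ≟ x) (λ { refl → ¬qy qx }))))

  Enumerates-filter : {xs : List A} {P Q : A → Set} (Q? : Decidable Q) →
                      Enumerates xs P → Enumerates (filter Q? xs) (λ x → P x × Q x)
  Enumerates-filter {xs} Q? enum (px , qx) = trans (multiplicity-filter Q? xs qx) (enum px)

  ∑-δ : (xs : List A) (F : A → ℕ) (x : A) → ∑[ y ← xs ] (δ y x * F y) ≡ multiplicity xs x * F x
  ∑-δ xs F x = trans (∑-cong (δ-subst F x) xs) (∑-*ʳ (F x) xs (λ y → δ y x))

  ∑-δ-enum : (xs : List A) {P : A → Set} → Enumerates xs P →
             (F : A → ℕ) {x : A} → P x → ∑[ y ← xs ] (δ y x * F y) ≡ F x
  ∑-δ-enum xs enum F {x} px = trans (∑-δ xs F x) (trans (cong (_* F x) (enum px)) (+-identityʳ (F x)))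

  ∑-by-multiplicity : (ys : List A) {P : A → Set} → Enumerates ys P → {xs : List A} → All P xs →
                      (F : A → ℕ) → ∑ xs F ≡ ∑[ y ← ys ] (multiplicity xs y * F y)
  ∑-by-multiplicity ys {P} enum {xs} all F = begin
    ∑ xs F                                 ≡⟨ ∑-congᴬ (pick all) ⟩
    ∑[ x ← xs ] ∑[ y ← ys ] (δ y x * F y)  ≡⟨ ∑-swap xs ys (λ x y → δ y x * F y) ⟩
    ∑[ y ← ys ] ∑[ x ← xs ] (δ y x * F y)  ≡⟨ ∑-cong (λ y → ∑-*ʳ (F y) xs (λ x → δ y x)) ys ⟩
    ∑[ y ← ys ] (∑[ x ← xs ] δ y x * F y)  ≡⟨ ∑-cong (λ y → cong (_* F y) (∑-cong (δ-sym y) xs)) ys ⟩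
    ∑[ y ← ys ] (multiplicity xs y * F y)  ∎
    where
    open ≡-Reasoning
    pick : ∀ {zs} → All P zs → All (λ x → F x ≡ ∑[ y ← ys ] (δ y x * F y)) zs
    pick [] = []
    pick (px ∷ pzs) = sym (∑-δ-enum ys enum F px) ∷ pick pzs

  -- p v · [w = f v] = q w · [v = g w] says that f and g are mutually inverse
  -- between the supports of p and q, along which p and q agree.
  ∑-bijection : (xs : List A) → Enumerates xs (λ _ → ⊤) → (p q : A → ℕ) (f g : A → A) →
                (∀ v w → p v * δ w (f v) ≡ q w * δ v (g w)) → ∑ xs p ≡ ∑ xs q
  ∑-bijection xs enum p q f g match = begin
    ∑ xs p                                    ≡⟨ ∑-cong (λ v → sym (collapse p f v)) xs ⟩
    ∑[ v ← xs ] ∑[ w ← xs ] (p v * δ w (f v)) ≡⟨ ∑-cong (λ v → ∑-cong (match v) xs) xs ⟩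
    ∑[ v ← xs ] ∑[ w ← xs ] (q w * δ v (g w)) ≡⟨ ∑-swap xs xs (λ v w → q w * δ v (g w)) ⟩
    ∑[ w ← xs ] ∑[ v ← xs ] (q w * δ v (g w)) ≡⟨ ∑-cong (collapse q g) xs ⟩
    ∑ xs q                                    ∎
    where
    open ≡-Reasoning
    collapse : (r : A → ℕ) (h : A → A) (v : A) → ∑[ w ← xs ] (r v * δ w (h v)) ≡ r v
    collapse r h v = trans (∑-*ˡ (r v) xs (λ w → δ w (h v)))
                           (trans (cong (r v *_) (enum tt)) (*-identityʳ (r v)))

-- Partitions

largestPart : List ℕ → ℕ
largestPart [] = 0
largestPart (a ∷ _) = a

data Partition≤ : ℕ → List ℕ → Set where
  [] : ∀ {B} → Partition≤ B []
  cons : ∀ {B a l} → 0 < a → a ≤ B → Partition≤ a l → Partition≤ B (a ∷ l)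

Partition≤-weaken : ∀ {B B′ l} → B ≤ B′ → Partition≤ B l → Partition≤ B′ l
Partition≤-weaken B≤B′ [] = []
Partition≤-weaken B≤B′ (cons pos a≤B p) = cons pos (≤-trans a≤B B≤B′) p

Partition≤-rebound : ∀ {B B′ l} → Partition≤ B l → largestPart l ≤ B′ → Partition≤ B′ l
Partition≤-rebound [] _ = []
Partition≤-rebound (cons pos _ p) a≤B′ = cons pos a≤B′ p

largestPart≤ : ∀ {B l} → Partition≤ B l → largestPart l ≤ B
largestPart≤ [] = z≤n
largestPart≤ (cons _ a≤B _) = a≤B

isPartition⇒Partition≤ : ∀ {l} → IsPartition l → Partition≤ (largestPart l) l
isPartition⇒Partition≤ {[]} _ = []
isPartition⇒Partition≤ {a ∷ []} (_ , pos ∷ []) = cons pos ≤-refl []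
isPartition⇒Partition≤ {a ∷ b ∷ l} (b≤a ∷ lk , pos ∷ poss) =
  cons pos ≤-refl (Partition≤-weaken b≤a (isPartition⇒Partition≤ (lk , poss)))

Partition≤⇒isPartition : ∀ {B l} → Partition≤ B l → IsPartition l
Partition≤⇒isPartition [] = [] , []
Partition≤⇒isPartition (cons pos _ []) = [-] , pos ∷ []
Partition≤⇒isPartition (cons pos _ p@(cons _ b≤a _)) with Partition≤⇒isPartition p
... | lk , poss = b≤a ∷ lk , pos ∷ poss

Partition≤-sum≡0 : ∀ {B l} → Partition≤ B l → sum l ≡ 0 → l ≡ []
Partition≤-sum≡0 [] _ = refl
Partition≤-sum≡0 (cons {a = suc _} _ _ _) ()

infix 4 _⊢_

_⊢_ : List ℕ → ℕ → Set
α ⊢ k = IsPartition α × sum α ≡ k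

largestPart≤size : ∀ {α k} → α ⊢ k → largestPart α ≤ k
largestPart≤size {[]} _ = z≤n
largestPart≤size {a ∷ α} (_ , refl) = m≤m+n a (sum α)

_≟ᴸ_ : DecidableEquality (List ℕ)
_≟ᴸ_ = ≡-dec _≟_

eqList≡does : ∀ l m → eqList l m ≡ does (l ≟ᴸ m)
eqList≡does [] [] = refl
eqList≡does [] (_ ∷ _) = refl
eqList≡does (_ ∷ _) [] = refl
eqList≡does (a ∷ l) (b ∷ m) = cong ((a ≡ᵇ b) ∧_) (eqList≡does l m)

eqList-true : ∀ l → eqList l l ≡ true
eqList-true l = trans (eqList≡does l l) (dec-true (l ≟ᴸ l) refl)

eqList-false : ∀ {l m} → l ≢ m → eqList l m ≡ false
eqList-false {l} {m} l≢m = trans (eqList≡does l m) (dec-false (l ≟ᴸ m) l≢m)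

open Counting _≟ᴸ_

module ℕ-Counting = Counting _≟_

δ-∷ : ∀ a b l m → δ (a ∷ l) (b ∷ m) ≡ ℕ-Counting.δ a b * δ l m
δ-∷ a b l m = 𝟙-∧ (does (a ≟ b)) (does (l ≟ᴸ m))

δ-∷-same : ∀ a l m → δ (a ∷ l) (a ∷ m) ≡ δ l m
δ-∷-same a l m = trans (δ-∷ a a l m) (trans (cong (_* δ l m) (ℕ-Counting.δ-refl a)) (*-identityˡ (δ l m)))

δ-∷-diff : ∀ {a b} l m → a ≢ b → δ (a ∷ l) (b ∷ m) ≡ 0
δ-∷-diff {a} {b} l m a≢b = trans (δ-∷ a b l m) (cong (_* δ l m) (𝟙-no (a ≟ b) a≢b))

-- Containment of Young diagrams (Defs.contained) is the prefix order on part lists.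
infix 4 _⊆_ _⊆?_

_⊆_ : List ℕ → List ℕ → Set
_⊆_ = Prefix _≤_

_⊆?_ : (μ l : List ℕ) → Dec (μ ⊆ l)
_⊆?_ = Prefixₚ.prefix? _≤?_

contained≡does : ∀ μ l → contained μ l ≡ does (μ ⊆? l)
contained≡does [] _ = refl
contained≡does (_ ∷ _) [] = refl
contained≡does (b ∷ μ) (a ∷ l) = cong ((b ≤ᵇ a) ∧_) (contained≡does μ l)

contained-true : ∀ {μ l} → μ ⊆ l → contained μ l ≡ true
contained-true {μ} {l} μ⊆l = trans (contained≡does μ l) (dec-true (μ ⊆? l) μ⊆l)

contained-false : ∀ {μ l} → ¬ μ ⊆ l → contained μ l ≡ false
contained-false {μ} {l} μ⊈l = trans (contained≡does μ l) (dec-false (μ ⊆? l) μ⊈l)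

⊆-refl : ∀ l → l ⊆ l
⊆-refl [] = []
⊆-refl (a ∷ l) = ≤-refl ∷ ⊆-refl l

⊆-trans : ∀ {l m n} → l ⊆ m → m ⊆ n → l ⊆ n
⊆-trans = Prefixₚ.trans ≤-trans

⊆⇒sum≤ : ∀ {μ l} → μ ⊆ l → sum μ ≤ sum l
⊆⇒sum≤ [] = z≤n
⊆⇒sum≤ (b≤a ∷ μ⊆l) = +-mono-≤ b≤a (⊆⇒sum≤ μ⊆l)

⊆-sum-≡⇒≡ : ∀ {μ l} → All (0 <_) l → μ ⊆ l → sum μ ≡ sum l → μ ≡ l
⊆-sum-≡⇒≡ [] [] _ = refl
⊆-sum-≡⇒≡ (_∷_ {x = suc a} _ _) [] ()
⊆-sum-≡⇒≡ {b ∷ μ} {a ∷ l} (_ ∷ poss) (b≤a ∷ μ⊆l) sum≡ =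
  cong₂ _∷_ b≡a (⊆-sum-≡⇒≡ poss μ⊆l tail≡)
  where
  b≡a : b ≡ a
  b≡a = ≤-antisym b≤a (+-cancelʳ-≤ (sum μ) a b
          (≤-trans (+-monoʳ-≤ a (⊆⇒sum≤ μ⊆l)) (≤-reflexive (sym sum≡))))
  tail≡ : sum μ ≡ sum l
  tail≡ = +-cancelˡ-≡ a (sum μ) (sum l) (trans (cong (_+ sum μ) (sym b≡a)) sum≡)

upTo-enumerates : ∀ n → ℕ-Counting.Enumerates (upTo n) (_< n)
upTo-enumerates n {b} b<n = trans (∑-applyUpTo id n (λ a → ℕ-Counting.δ a b)) (count n b b<n)
  where
  count : ∀ n b → b < n → ∑[ a < n ] ℕ-Counting.δ a b ≡ 1
  count (suc n) zero _ = cong suc (∑<-zero n (λ _ → refl))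
  count (suc n) (suc b) (s≤s b<n) = count n b b<n

partsFuel-sound : ∀ f m p → All (λ l → Partition≤ p l × sum l ≡ m) (partsFuel f m p)
partsFuel-sound f zero p = ([] , refl) ∷ []
partsFuel-sound zero (suc m) p = []
partsFuel-sound (suc f) (suc m) p =
  Allₚ.concat⁺ (Allₚ.map⁺ (All.map prepend (All.zip (Allₚ.filter⁺ (λ a → suc a ≤? p) (Allₚ.all-upTo (suc m)) ,
                                                    Allₚ.all-filter (λ a → suc a ≤? p) (upTo (suc m))))))
  where
  prepend : ∀ {a} → a < suc m × suc a ≤ p →
            All (λ l → Partition≤ p l × sum l ≡ suc m) (map (suc a ∷_) (partsFuel f (m ∸ a) (suc a)))
  prepend {a} (s≤s a≤m , a<p) =
    Allₚ.map⁺ (All.map (λ (part , s) → cons (s≤s z≤n) a<p part , cong suc (trans (cong (a +_) s) (m+[n∸m]≡n a≤m)))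
                       (partsFuel-sound f (m ∸ a) (suc a)))

partitionsOf-sound : ∀ m → All (_⊢ m) (partitionsOf m)
partitionsOf-sound m = All.map (λ (part , s) → Partition≤⇒isPartition part , s) (partsFuel-sound m m m)

partsFuel-enumerates : ∀ f m p → m ≤ f → Enumerates (partsFuel f m p) (λ l → Partition≤ p l × sum l ≡ m)
partsFuel-enumerates f zero p _ (part , s) rewrite Partition≤-sum≡0 part s = refl
partsFuel-enumerates (suc f) (suc m) p (s≤s m≤f) {suc a₀ ∷ α} (cons _ a₀<p part , s) = begin
  multiplicity (concatMap G candidates) (suc a₀ ∷ α)
    ≡⟨ ∑-concatMap G candidates (λ y → δ y (suc a₀ ∷ α)) ⟩
  ∑[ a ← candidates ] ∑[ y ← G a ] δ y (suc a₀ ∷ α)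
    ≡⟨ ∑-cong (λ a → trans (∑-map (suc a ∷_) (rest a) (λ y → δ y (suc a₀ ∷ α)))
                            (trans (∑-cong (λ y → δ-∷ (suc a) (suc a₀) y α) (rest a))
                                   (∑-*ˡ (ℕ-Counting.δ a a₀) (rest a) (λ y → δ y α)))) candidates ⟩
  ∑[ a ← candidates ] (ℕ-Counting.δ a a₀ * multiplicity (rest a) α)
    ≡⟨ ℕ-Counting.∑-δ-enum candidates
         (ℕ-Counting.Enumerates-filter {upTo (suc m)} (λ a → suc a ≤? p) (upTo-enumerates (suc m)))
         (λ a → multiplicity (rest a) α) (s≤s a₀≤m , a₀<p) ⟩
  multiplicity (rest a₀) α
    ≡⟨ partsFuel-enumerates f (m ∸ a₀) (suc a₀) (≤-trans (m∸n≤m m a₀) m≤f) (part , sum-rest) ⟩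
  1 ∎
  where
  open ≡-Reasoning
  candidates = filter (λ a → suc a ≤? p) (upTo (suc m))
  rest : ℕ → List (List ℕ)
  rest a = partsFuel f (m ∸ a) (suc a)
  G : ℕ → List (List ℕ)
  G a = map (suc a ∷_) (rest a)
  a₀≤m : a₀ ≤ m
  a₀≤m = subst (a₀ ≤_) (suc-injective s) (m≤m+n a₀ (sum α))
  sum-rest : sum α ≡ m ∸ a₀
  sum-rest = trans (sym (m+n∸m≡n a₀ (sum α))) (cong (_∸ a₀) (suc-injective s))

partitionsOf-enumerates : ∀ m → Enumerates (partitionsOf m) (_⊢ m)
partitionsOf-enumerates m (isPart , s) =
  partsFuel-enumerates m m m ≤-refl
    (Partition≤-weaken (largestPart≤size (isPart , s)) (isPartition⇒Partition≤ isPart) , s)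

-- Covers in Young's lattice

<ᵇ-true : ∀ {m n} → m < n → (m <ᵇ n) ≡ true
<ᵇ-true {m} {n} = dec-true (m <? n)

<ᵇ-false : ∀ {m n} → ¬ m < n → (m <ᵇ n) ≡ false
<ᵇ-false {m} {n} = dec-false (m <? n)

removeFromFirst : ℕ → List ℕ → List ℕ
removeFromFirst (suc zero) l = l
removeFromFirst a l = (a ∸ 1) ∷ l

-- Defs.removeCorner reorganised into a single recursive clause.
lowerCovers : List ℕ → List (List ℕ)
lowerCovers [] = []
lowerCovers (a ∷ l) = (if largestPart l <ᵇ a then [ removeFromFirst a l ] else [])
                      ++ map (a ∷_) (lowerCovers l)

-- Upper covers with first part at most B; the bound lets the recursion descend into the tail.
upperCovers≤ : ℕ → List ℕ → List (List ℕ)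
upperCovers≤ B [] = if 0 <ᵇ B then [ 1 ∷ [] ] else []
upperCovers≤ B (a ∷ l) = (if a <ᵇ B then [ suc a ∷ l ] else [])
                         ++ map (a ∷_) (upperCovers≤ a l)

upperCovers : List ℕ → List (List ℕ)
upperCovers l = upperCovers≤ (suc (largestPart l)) l

∑-lowerCovers-∷ : ∀ a l (F : List ℕ → ℕ) →
  ∑ (lowerCovers (a ∷ l)) F ≡ (if largestPart l <ᵇ a then F (removeFromFirst a l) else 0)
                              + ∑[ ρ ← lowerCovers l ] F (a ∷ ρ)
∑-lowerCovers-∷ a l F =
  trans (∑-++ (if largestPart l <ᵇ a then [ removeFromFirst a l ] else []) (map (a ∷_) (lowerCovers l)) F)
        (cong₂ _+_ (∑-if-[ largestPart l <ᵇ a ] (removeFromFirst a l) F) (∑-map (a ∷_) (lowerCovers l) F))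

∑-upperCovers≤-∷ : ∀ B a l (F : List ℕ → ℕ) →
  ∑ (upperCovers≤ B (a ∷ l)) F ≡ (if a <ᵇ B then F (suc a ∷ l) else 0)
                                + ∑[ ν ← upperCovers≤ a l ] F (a ∷ ν)
∑-upperCovers≤-∷ B a l F =
  trans (∑-++ (if a <ᵇ B then [ suc a ∷ l ] else []) (map (a ∷_) (upperCovers≤ a l)) F)
        (cong₂ _+_ (∑-if-[ a <ᵇ B ] (suc a ∷ l) F) (∑-map (a ∷_) (upperCovers≤ a l) F))

∑-upperCovers≤-[] : ∀ B (F : List ℕ → ℕ) → ∑ (upperCovers≤ B []) F ≡ (if 0 <ᵇ B then F (1 ∷ []) else 0)
∑-upperCovers≤-[] B F = ∑-if-[ 0 <ᵇ B ] (1 ∷ []) F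

removeFromFirst-pred : ∀ {a} l → 1 < a → removeFromFirst a l ≡ (a ∸ 1) ∷ l
removeFromFirst-pred {suc (suc _)} l _ = refl
removeFromFirst-pred {suc zero} l (s≤s ())

removeCorner≡lowerCovers : ∀ {l} → All (0 <_) l → removeCorner l ≡ lowerCovers l
removeCorner≡lowerCovers [] = refl
removeCorner≡lowerCovers {suc zero ∷ []} (_ ∷ []) = refl
removeCorner≡lowerCovers {suc (suc _) ∷ []} (_ ∷ []) = refl
removeCorner≡lowerCovers {a ∷ b ∷ l} (_ ∷ poss) rewrite removeCorner≡lowerCovers poss
  with b <ᵇ a | <ᵇ-reflects-< b a | poss
... | false | _ | _ = refl
... | true | ofʸ b<a | 0<b ∷ _ =
  cong (λ r → [ r ] ++ map (a ∷_) (lowerCovers (b ∷ l))) (sym (removeFromFirst-pred (b ∷ l) (≤-<-trans 0<b b<a)))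

module _ {A : Set} {P : A → Set} where

  All-if-[_] : {Q : Set} (Q? : Dec Q) {x : A} → (Q → P x) → All P (if does Q? then [ x ] else [])
  All-if-[ yes q ] f = f q ∷ []
  All-if-[ no _ ] f = []

lowerCovers-shape : ∀ {B lam} → Partition≤ B lam →
                    All (λ ρ → Partition≤ B ρ × suc (sum ρ) ≡ sum lam) (lowerCovers lam)
lowerCovers-shape [] = []
lowerCovers-shape {B} {a ∷ l} (cons pos a≤B p) =
  Allₚ.++⁺ (All-if-[ largestPart l <? a ] (shrunk pos a≤B p))
           (Allₚ.map⁺ (All.map (λ (p′ , s) → cons pos a≤B p′ , trans (sym (+-suc a _)) (cong (a +_) s))
                               (lowerCovers-shape p)))
  where
  shrunk : ∀ {a} → 0 < a → a ≤ B → Partition≤ a l → largestPart l < a →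
           Partition≤ B (removeFromFirst a l) × suc (sum (removeFromFirst a l)) ≡ a + sum l
  shrunk {suc zero} _ a≤B p _ = Partition≤-weaken a≤B p , refl
  shrunk {suc (suc c)} _ a≤B p (s≤s lp≤c) =
    cons (s≤s z≤n) (≤-trans (n≤1+n _) a≤B) (Partition≤-rebound p lp≤c) , refl

upperCovers≤-shape : ∀ {B lam} → Partition≤ B lam →
                     All (λ ν → Partition≤ B ν × sum ν ≡ suc (sum lam)) (upperCovers≤ B lam)
upperCovers≤-shape {B} [] = All-if-[ 0 <? B ] (λ 0<B → cons (s≤s z≤n) 0<B [] , refl)
upperCovers≤-shape {B} {a ∷ l} (cons pos a≤B p) =
  Allₚ.++⁺ (All-if-[ a <? B ] (λ a<B → cons (s≤s z≤n) a<B (Partition≤-weaken (n≤1+n a) p) , refl))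
           (Allₚ.map⁺ (All.map (λ (p′ , s) → cons pos a≤B p′ , trans (cong (a +_) s) (+-suc a _))
                               (upperCovers≤-shape p)))

upperCovers-shape : ∀ {ρ} → IsPartition ρ →
                    All (λ ν → Partition≤ (suc (largestPart ρ)) ν × sum ν ≡ suc (sum ρ)) (upperCovers ρ)
upperCovers-shape isPart = upperCovers≤-shape (Partition≤-weaken (n≤1+n _) (isPartition⇒Partition≤ isPart))

lowerCovers-⊢ : ∀ {lam N} → lam ⊢ suc N → All (_⊢ N) (lowerCovers lam)
lowerCovers-⊢ (isPart , size) =
  All.map (λ (p , s) → Partition≤⇒isPartition p , suc-injective (trans s size))
          (lowerCovers-shape (isPartition⇒Partition≤ isPart))

upperCovers-⊢ : ∀ {ρ N} → ρ ⊢ N → All (_⊢ suc N) (upperCovers ρ)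
upperCovers-⊢ (isPart , size) =
  All.map (λ (p , s) → Partition≤⇒isPartition p , trans s (cong suc size)) (upperCovers-shape isPart)

lowerCovers-⊆ : ∀ {B lam} → Partition≤ B lam → All (_⊆ lam) (lowerCovers lam)
lowerCovers-⊆ [] = []
lowerCovers-⊆ {lam = a ∷ l} (cons pos _ p) =
  Allₚ.++⁺ (All-if-[ largestPart l <? a ] (shrunk pos p)) (Allₚ.map⁺ (All.map (≤-refl ∷_) (lowerCovers-⊆ p)))
  where
  shrunk : ∀ {a} → 0 < a → Partition≤ a l → largestPart l < a → removeFromFirst a l ⊆ a ∷ l
  shrunk {suc zero} _ [] _ = []
  shrunk {suc zero} _ (cons 0<h _ _) (s≤s h≤0) = ⊥-elim (<⇒≱ 0<h h≤0)
  shrunk {suc (suc c)} _ _ _ = n≤1+n (suc c) ∷ ⊆-refl l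

upperCovers≤≡upperCovers : ∀ {B} σ → largestPart σ < B → upperCovers≤ B σ ≡ upperCovers σ
upperCovers≤≡upperCovers [] lp<B rewrite <ᵇ-true lp<B = refl
upperCovers≤≡upperCovers (a ∷ σ) lp<B rewrite <ᵇ-true lp<B | <ᵇ-true (n<1+n a) = refl

#upperCovers≤ : ∀ B lam → ∑[ ν ← upperCovers≤ B lam ] 1 ≡ ∑[ ρ ← lowerCovers lam ] 1 + 𝟙 (largestPart lam <ᵇ B)
#upperCovers≤ B [] = ∑-upperCovers≤-[] B (λ _ → 1)
#upperCovers≤ B (a ∷ l) = begin
  ∑[ ν ← upperCovers≤ B (a ∷ l) ] 1
    ≡⟨ ∑-upperCovers≤-∷ B a l (λ _ → 1) ⟩
  𝟙 (a <ᵇ B) + ∑[ ν ← upperCovers≤ a l ] 1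
    ≡⟨ cong (𝟙 (a <ᵇ B) +_) (#upperCovers≤ a l) ⟩
  𝟙 (a <ᵇ B) + (∑[ ρ ← lowerCovers l ] 1 + 𝟙 (largestPart l <ᵇ a))
    ≡⟨ solve 3 (λ x y z → x :+ (y :+ z) := (z :+ y) :+ x) refl
             (𝟙 (a <ᵇ B)) (∑[ ρ ← lowerCovers l ] 1) (𝟙 (largestPart l <ᵇ a)) ⟩
  (𝟙 (largestPart l <ᵇ a) + ∑[ ρ ← lowerCovers l ] 1) + 𝟙 (a <ᵇ B)
    ≡⟨ cong (_+ 𝟙 (a <ᵇ B)) (sym (∑-lowerCovers-∷ a l (λ _ → 1))) ⟩
  ∑[ ρ ← lowerCovers (a ∷ l) ] 1 + 𝟙 (a <ᵇ B) ∎
  where open ≡-Reasoning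

∑-upperCovers≤-restrict : ∀ c l (H : List ℕ → ℕ) → largestPart l ≤ c →
  ∑[ ν ← upperCovers≤ (suc c) l ] (if largestPart ν <ᵇ suc c then H ν else 0) ≡ ∑ (upperCovers≤ c l) H
∑-upperCovers≤-restrict c [] H _ =
  trans (∑-upperCovers≤-[] (suc c) (λ ν → if largestPart ν <ᵇ suc c then H ν else 0))
        (sym (∑-upperCovers≤-[] c H))
∑-upperCovers≤-restrict c (h ∷ l) H h≤c = begin
  ∑ (upperCovers≤ (suc c) (h ∷ l)) F
    ≡⟨ ∑-upperCovers≤-∷ (suc c) h l F ⟩
  (if h <ᵇ suc c then F (suc h ∷ l) else 0) + ∑[ ν ← upperCovers≤ h l ] F (h ∷ ν)
    ≡⟨ cong (λ b → (if b then F (suc h ∷ l) else 0) + ∑[ ν ← upperCovers≤ h l ] (if b then H (h ∷ ν) else 0))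
            (<ᵇ-true (s≤s h≤c)) ⟩
  F (suc h ∷ l) + ∑[ ν ← upperCovers≤ h l ] H (h ∷ ν)
    ≡⟨ sym (∑-upperCovers≤-∷ c h l H) ⟩
  ∑ (upperCovers≤ c (h ∷ l)) H ∎
  where
  open ≡-Reasoning
  F : List ℕ → ℕ
  F ν = if largestPart ν <ᵇ suc c then H ν else 0

∑-upperCovers≤-removeFromFirst : ∀ {B a l} (G : List ℕ → ℕ) → Partition≤ B (a ∷ l) →
  (if largestPart l <ᵇ a then ∑ (upperCovers≤ B (removeFromFirst a l)) G else 0)
    ≡ (if largestPart l <ᵇ a then G (a ∷ l) else 0)
      + ∑[ ν ← upperCovers≤ a l ] (if largestPart ν <ᵇ a then G (removeFromFirst a ν) else 0)
∑-upperCovers≤-removeFromFirst {a = a} {l} G p with largestPart l <ᵇ a | <ᵇ-reflects-< (largestPart l) a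
∑-upperCovers≤-removeFromFirst {l = []} G (cons 0<a _ _) | false | ofⁿ ¬0<a = ⊥-elim (¬0<a 0<a)
∑-upperCovers≤-removeFromFirst {a = a} {h ∷ l} G p | false | ofⁿ ¬h<a = sym (begin
  ∑ (upperCovers≤ a (h ∷ l)) F
    ≡⟨ ∑-upperCovers≤-∷ a h l F ⟩
  (if h <ᵇ a then F (suc h ∷ l) else 0)
    + ∑[ ν ← upperCovers≤ h l ] (if h <ᵇ a then G (removeFromFirst a (h ∷ ν)) else 0)
    ≡⟨ cong (λ b → (if b then F (suc h ∷ l) else 0)
                   + ∑[ ν ← upperCovers≤ h l ] (if b then G (removeFromFirst a (h ∷ ν)) else 0))
            (<ᵇ-false ¬h<a) ⟩
  ∑[ ν ← upperCovers≤ h l ] 0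
    ≡⟨ ∑-zero (upperCovers≤ h l) ⟩
  0 ∎)
  where
  open ≡-Reasoning
  F : List ℕ → ℕ
  F ν = if largestPart ν <ᵇ a then G (removeFromFirst a ν) else 0
∑-upperCovers≤-removeFromFirst {suc B} {suc zero} {[]} G p | true | _ = refl
∑-upperCovers≤-removeFromFirst {zero} {suc zero} {[]} G (cons _ () _) | true | _
∑-upperCovers≤-removeFromFirst {a = zero} G (cons () _ _) | true | _
∑-upperCovers≤-removeFromFirst {a = suc zero} {h ∷ l} G (cons _ _ (cons 0<h _ _)) | true | ofʸ (s≤s h≤0) =
  ⊥-elim (<⇒≱ 0<h h≤0)
∑-upperCovers≤-removeFromFirst {B} {suc (suc c)} {l} G (cons _ a≤B _) | true | ofʸ (s≤s lp≤c) = begin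
  ∑ (upperCovers≤ B (suc c ∷ l)) G
    ≡⟨ ∑-upperCovers≤-∷ B (suc c) l G ⟩
  (if suc c <ᵇ B then G (suc (suc c) ∷ l) else 0) + ∑[ ν ← upperCovers≤ (suc c) l ] G (suc c ∷ ν)
    ≡⟨ cong₂ _+_ (if-cong (<ᵇ-true a≤B)) (sym (∑-upperCovers≤-restrict (suc c) l (λ ν → G (suc c ∷ ν)) lp≤c)) ⟩
  G (suc (suc c) ∷ l)
    + ∑[ ν ← upperCovers≤ (suc (suc c)) l ] (if largestPart ν <ᵇ suc (suc c) then G (suc c ∷ ν) else 0) ∎
  where open ≡-Reasoning

∑-lowerCovers-suc∷ : ∀ {a l} (G : List ℕ → ℕ) → 0 < a → Partition≤ a l →
  ∑ (lowerCovers (suc a ∷ l)) G ≡ G (a ∷ l) + ∑[ ρ ← lowerCovers l ] G (suc a ∷ ρ)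
∑-lowerCovers-suc∷ {suc a} {l} G _ p =
  trans (∑-lowerCovers-∷ (suc (suc a)) l G)
        (cong (_+ ∑[ ρ ← lowerCovers l ] G (suc (suc a) ∷ ρ)) (if-cong (<ᵇ-true (s≤s (largestPart≤ p)))))

-- The commutation relation DU = UD + I of Young's lattice, for covers bounded by B.
∑-upperCovers≤-lowerCovers : ∀ {B lam} (G : List ℕ → ℕ) → Partition≤ B lam →
  ∑[ ν ← upperCovers≤ B lam ] ∑ (lowerCovers ν) G
    ≡ (if largestPart lam <ᵇ B then G lam else 0) + ∑[ σ ← lowerCovers lam ] ∑ (upperCovers≤ B σ) G
∑-upperCovers≤-lowerCovers {zero} G [] = refl
∑-upperCovers≤-lowerCovers {suc B} G [] = cong (_+ 0) (+-identityʳ (G []))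
∑-upperCovers≤-lowerCovers {B} {a ∷ l} G p@(cons 0<a _ pₗ) = begin
  ∑ (upperCovers≤ B (a ∷ l)) Φ
    ≡⟨ ∑-upperCovers≤-∷ B a l Φ ⟩
  (if a <ᵇ B then Φ (suc a ∷ l) else 0) + ∑[ ν ← upperCovers≤ a l ] Φ (a ∷ ν)
    ≡⟨ cong₂ _+_ (if-cong-then (a <ᵇ B) (∑-lowerCovers-suc∷ G 0<a pₗ)) tail-up ⟩
  (if a <ᵇ B then G (a ∷ l) + Z else 0) + (K + (C₂ + Y))
    ≡⟨ rearrange (a <ᵇ B) ⟩
  C₁ + ((C₂ + K) + ((if a <ᵇ B then Z else 0) + Y))
    ≡⟨ cong (C₁ +_) (cong₂ _+_ (sym (∑-upperCovers≤-removeFromFirst G p)) (sym tail-down)) ⟩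
  C₁ + ((if largestPart l <ᵇ a then Ψ (removeFromFirst a l) else 0) + ∑[ σ ← lowerCovers l ] Ψ (a ∷ σ))
    ≡⟨ cong (C₁ +_) (sym (∑-lowerCovers-∷ a l Ψ)) ⟩
  C₁ + ∑ (lowerCovers (a ∷ l)) Ψ ∎
  where
  open ≡-Reasoning
  Φ Ψ Gₐ : List ℕ → ℕ
  Φ ν = ∑ (lowerCovers ν) G
  Ψ σ = ∑ (upperCovers≤ B σ) G
  Gₐ ρ = G (a ∷ ρ)
  C₁ C₂ Z K Y : ℕ
  C₁ = if a <ᵇ B then G (a ∷ l) else 0
  C₂ = if largestPart l <ᵇ a then G (a ∷ l) else 0
  Z = ∑[ ρ ← lowerCovers l ] G (suc a ∷ ρ)
  K = ∑[ ν ← upperCovers≤ a l ] (if largestPart ν <ᵇ a then G (removeFromFirst a ν) else 0)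
  Y = ∑[ σ ← lowerCovers l ] ∑ (upperCovers≤ a σ) Gₐ
  tail-up : ∑[ ν ← upperCovers≤ a l ] Φ (a ∷ ν) ≡ K + (C₂ + Y)
  tail-up = begin
    ∑[ ν ← upperCovers≤ a l ] Φ (a ∷ ν)
      ≡⟨ ∑-cong (λ ν → ∑-lowerCovers-∷ a ν G) (upperCovers≤ a l) ⟩
    ∑[ ν ← upperCovers≤ a l ] ((if largestPart ν <ᵇ a then G (removeFromFirst a ν) else 0) + ∑ (lowerCovers ν) Gₐ)
      ≡⟨ ∑-+ (upperCovers≤ a l) _ _ ⟩
    K + ∑[ ν ← upperCovers≤ a l ] ∑ (lowerCovers ν) Gₐ
      ≡⟨ cong (K +_) (∑-upperCovers≤-lowerCovers Gₐ pₗ) ⟩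
    K + (C₂ + Y) ∎
  tail-down : ∑[ σ ← lowerCovers l ] Ψ (a ∷ σ) ≡ (if a <ᵇ B then Z else 0) + Y
  tail-down = begin
    ∑[ σ ← lowerCovers l ] Ψ (a ∷ σ)
      ≡⟨ ∑-cong (λ σ → ∑-upperCovers≤-∷ B a σ G) (lowerCovers l) ⟩
    ∑[ σ ← lowerCovers l ] ((if a <ᵇ B then G (suc a ∷ σ) else 0) + ∑ (upperCovers≤ a σ) Gₐ)
      ≡⟨ ∑-+ (lowerCovers l) _ _ ⟩
    ∑[ σ ← lowerCovers l ] (if a <ᵇ B then G (suc a ∷ σ) else 0) + Y
      ≡⟨ cong (_+ Y) (∑-if (a <ᵇ B) (lowerCovers l) (λ σ → G (suc a ∷ σ))) ⟩
    (if a <ᵇ B then Z else 0) + Y ∎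
  rearrange : ∀ b → (if b then G (a ∷ l) + Z else 0) + (K + (C₂ + Y))
                    ≡ (if b then G (a ∷ l) else 0) + ((C₂ + K) + ((if b then Z else 0) + Y))
  rearrange true = solve 5 (λ g z k c y → (g :+ z) :+ (k :+ (c :+ y)) := g :+ ((c :+ k) :+ (z :+ y))) refl
                           (G (a ∷ l)) Z K C₂ Y
  rearrange false = solve 3 (λ k c y → k :+ (c :+ y) := (c :+ k) :+ y) refl K C₂ Y

multiplicity-upperCovers≤-[] : ∀ B ρ → multiplicity (upperCovers≤ B ρ) [] ≡ 0
multiplicity-upperCovers≤-[] zero [] = refl
multiplicity-upperCovers≤-[] (suc B) [] = refl
multiplicity-upperCovers≤-[] B (b ∷ r) =
  trans (∑-upperCovers≤-∷ B b r (λ x → δ x [])) (cong₂ _+_ (if-eta (b <ᵇ B)) (∑-zero (upperCovers≤ b r)))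

δ-removeFromFirst-[] : ∀ {B a l} → 0 < a → Partition≤ a l → a ≤ B ⊎ 0 < B →
  (if largestPart l <ᵇ a then δ (removeFromFirst a l) [] else 0) ≡ (if 0 <ᵇ B then δ (1 ∷ []) (a ∷ l) else 0)
δ-removeFromFirst-[] {B} {suc zero} _ [] (inj₁ 1≤B) rewrite <ᵇ-true 1≤B = refl
δ-removeFromFirst-[] {B} {suc zero} _ [] (inj₂ 0<B) rewrite <ᵇ-true 0<B = refl
δ-removeFromFirst-[] {B} {suc zero} _ (cons {a = suc _} _ _ _) _ = sym (if-eta (0 <ᵇ B))
δ-removeFromFirst-[] {B} {suc (suc c)} {l} _ _ _ =
  trans (if-eta (largestPart l <ᵇ suc (suc c))) (sym (if-eta (0 <ᵇ B)))

δ-removeFromFirst-∷ : ∀ {B a b l r} → 0 < a → Partition≤ a l → 0 < b → Partition≤ b r → a ≤ B ⊎ b < B →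
  (if largestPart l <ᵇ a then δ (removeFromFirst a l) (b ∷ r) else 0)
    ≡ (if b <ᵇ B then δ (suc b ∷ r) (a ∷ l) else 0)
δ-removeFromFirst-∷ {B} {suc zero} {suc _} _ [] _ _ _ = sym (if-eta (_ <ᵇ B))
δ-removeFromFirst-∷ {B} {suc zero} {suc _} _ (cons {a = suc _} _ _ _) _ _ _ = sym (if-eta (_ <ᵇ B))
δ-removeFromFirst-∷ {B} {suc (suc c)} {b} {l} {r} _ _ _ pᵣ bound with b ≟ suc c
... | no b≢1+c =
  trans (if-cong-then (largestPart l <ᵇ suc (suc c)) (δ-∷-diff l r (b≢1+c ∘ sym)))
        (trans (if-eta (largestPart l <ᵇ suc (suc c)))
               (sym (trans (if-cong-then (b <ᵇ B) (δ-∷-diff r l (b≢1+c ∘ suc-injective))) (if-eta (b <ᵇ B)))))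
... | yes refl rewrite <ᵇ-true (reduce bound) | δ-∷-same (suc (suc c)) r l | δ-∷-same (suc c) l r
  with l ≟ᴸ r
...   | yes refl rewrite <ᵇ-true (s≤s (largestPart≤ pᵣ)) = sym (δ-refl l)
...   | no l≢r = trans (if-eta (largestPart l <ᵇ suc (suc c))) (sym (𝟙-no (r ≟ᴸ l) (l≢r ∘ sym)))

multiplicity-lowerCovers≡multiplicity-upperCovers≤ :
  ∀ {B₁ B₂} B lam ρ → Partition≤ B₁ lam → Partition≤ B₂ ρ → largestPart lam ≤ B ⊎ largestPart ρ < B →
  multiplicity (lowerCovers lam) ρ ≡ multiplicity (upperCovers≤ B ρ) lam
multiplicity-lowerCovers≡multiplicity-upperCovers≤ B [] ρ _ _ _ = sym (multiplicity-upperCovers≤-[] B ρ)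
multiplicity-lowerCovers≡multiplicity-upperCovers≤ B (a ∷ l) [] (cons 0<a _ pₗ) _ bound =
  trans (∑-lowerCovers-∷ a l (λ x → δ x []))
        (trans (cong₂ _+_ (δ-removeFromFirst-[] 0<a pₗ bound) (∑-zero (lowerCovers l)))
               (trans (+-identityʳ _) (sym (∑-upperCovers≤-[] B (λ x → δ x (a ∷ l))))))
multiplicity-lowerCovers≡multiplicity-upperCovers≤ B (a ∷ l) (b ∷ r) (cons 0<a _ pₗ) (cons 0<b _ pᵣ) bound =
  trans (∑-lowerCovers-∷ a l (λ x → δ x (b ∷ r)))
        (trans (cong₂ _+_ (δ-removeFromFirst-∷ 0<a pₗ 0<b pᵣ bound) tails)
               (sym (∑-upperCovers≤-∷ B b r (λ x → δ x (a ∷ l)))))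
  where
  tails : ∑[ x ← lowerCovers l ] δ (a ∷ x) (b ∷ r) ≡ ∑[ x ← upperCovers≤ b r ] δ (b ∷ x) (a ∷ l)
  tails with a ≟ b
  ... | yes refl =
    trans (∑-cong (λ x → δ-∷-same a x r) (lowerCovers l))
          (trans (multiplicity-lowerCovers≡multiplicity-upperCovers≤ a l r pₗ pᵣ (inj₁ (largestPart≤ pₗ)))
                 (sym (∑-cong (λ x → δ-∷-same a x l) (upperCovers≤ a r))))
  ... | no a≢b =
    trans (trans (∑-cong (λ x → δ-∷-diff x r a≢b) (lowerCovers l)) (∑-zero (lowerCovers l)))
          (sym (trans (∑-cong (λ x → δ-∷-diff x l (a≢b ∘ sym)) (upperCovers≤ b r)) (∑-zero (upperCovers≤ b r))))

∑-lowerCovers-exchange : ∀ N (H : List ℕ → List ℕ → ℕ) →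
  ∑[ lam ← partitionsOf (suc N) ] ∑[ ρ ← lowerCovers lam ] H ρ lam
    ≡ ∑[ ρ ← partitionsOf N ] ∑[ lam ← upperCovers ρ ] H ρ lam
∑-lowerCovers-exchange N H = begin
  ∑[ lam ← P₁ ] ∑[ ρ ← lowerCovers lam ] H ρ lam
    ≡⟨ ∑-congᴬ (All.map (λ lam⊢ → ∑-by-multiplicity P₀ (partitionsOf-enumerates N) (lowerCovers-⊢ lam⊢) _)
                        (partitionsOf-sound (suc N))) ⟩
  ∑[ lam ← P₁ ] ∑[ ρ ← P₀ ] (multiplicity (lowerCovers lam) ρ * H ρ lam)
    ≡⟨ ∑-swap P₁ P₀ _ ⟩
  ∑[ ρ ← P₀ ] ∑[ lam ← P₁ ] (multiplicity (lowerCovers lam) ρ * H ρ lam)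
    ≡⟨ ∑-congᴬ (All.map (λ ρ⊢ → ∑-congᴬ (All.map (λ lam⊢ → cong (_* H _ _) (duality ρ⊢ lam⊢))
                                                 (partitionsOf-sound (suc N))))
                        (partitionsOf-sound N)) ⟩
  ∑[ ρ ← P₀ ] ∑[ lam ← P₁ ] (multiplicity (upperCovers ρ) lam * H ρ lam)
    ≡⟨ ∑-congᴬ (All.map (λ ρ⊢ → sym (∑-by-multiplicity P₁ (partitionsOf-enumerates (suc N)) (upperCovers-⊢ ρ⊢) _))
                        (partitionsOf-sound N)) ⟩
  ∑[ ρ ← P₀ ] ∑[ lam ← upperCovers ρ ] H ρ lam ∎
  where
  open ≡-Reasoning
  P₀ = partitionsOf N
  P₁ = partitionsOf (suc N)
  duality : ∀ {ρ lam} → ρ ⊢ N → lam ⊢ suc N → multiplicity (lowerCovers lam) ρ ≡ multiplicity (upperCovers ρ) lam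
  duality {ρ} {lam} (isPartρ , _) (isPartlam , _) =
    multiplicity-lowerCovers≡multiplicity-upperCovers≤ (suc (largestPart ρ)) lam ρ
      (isPartition⇒Partition≤ isPartlam) (isPartition⇒Partition≤ isPartρ) (inj₂ ≤-refl)

-- Skew tableaux

f^-refl : ∀ μ → f^ μ μ ≡ 1
f^-refl μ rewrite eqList-true μ = refl

skewFuel-⊈ : ∀ f {lam μ} → ¬ μ ⊆ lam → skewFuel f lam μ ≡ 0
skewFuel-⊈ f {lam} {μ} μ⊈lam
  rewrite eqList-false {lam} {μ} (λ { refl → μ⊈lam (⊆-refl lam) }) | contained-false μ⊈lam = refl

skewFuel-step : ∀ f {lam μ} → lam ≢ μ → μ ⊆ lam →
                skewFuel (suc f) lam μ ≡ ∑[ ν ← removeCorner lam ] skewFuel f ν μ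
skewFuel-step f lam≢μ μ⊆lam rewrite eqList-false lam≢μ | contained-true μ⊆lam = refl

f^-step : ∀ {lam μ} → IsPartition lam → lam ≢ μ → f^ lam μ ≡ ∑[ ρ ← lowerCovers lam ] f^ ρ μ
f^-step {lam} {μ} isPart lam≢μ with μ ⊆? lam
f^-step {[]} {[]} _ lam≢μ | yes [] = contradiction refl lam≢μ
f^-step {zero ∷ _} (_ , () ∷ _) _ | yes _
f^-step {suc a ∷ l} {μ} isPart@(_ , poss) lam≢μ | yes μ⊆lam = begin
  skewFuel (suc (a + sum l)) (suc a ∷ l) μ
    ≡⟨ skewFuel-step (a + sum l) lam≢μ μ⊆lam ⟩
  ∑[ ν ← removeCorner (suc a ∷ l) ] skewFuel (a + sum l) ν μ
    ≡⟨ cong (λ νs → ∑[ ν ← νs ] skewFuel (a + sum l) ν μ) (removeCorner≡lowerCovers poss) ⟩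
  ∑[ ν ← lowerCovers (suc a ∷ l) ] skewFuel (a + sum l) ν μ
    ≡⟨ ∑-congᴬ (All.map (λ {ν} (_ , size) → cong (λ f → skewFuel f ν μ) (suc-injective (sym size)))
                        (lowerCovers-shape (isPartition⇒Partition≤ isPart))) ⟩
  ∑[ ν ← lowerCovers (suc a ∷ l) ] f^ ν μ ∎
  where open ≡-Reasoning
f^-step {lam} {μ} isPart lam≢μ | no μ⊈lam =
  trans (skewFuel-⊈ (sum lam) μ⊈lam)
        (sym (∑-zeroᴬ (All.map (λ ρ⊆lam → skewFuel-⊈ _ (λ μ⊆ρ → μ⊈lam (⊆-trans μ⊆ρ ρ⊆lam)))
                               (lowerCovers-⊆ (isPartition⇒Partition≤ isPart)))))

f^-same-size : ∀ {lam μ} → All (0 <_) lam → sum μ ≡ sum lam → f^ lam μ ≡ δ lam μ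
f^-same-size {lam} {μ} poss size with lam ≟ᴸ μ
... | yes refl = f^-refl lam
... | no lam≢μ = skewFuel-⊈ (sum lam) (λ μ⊆lam → lam≢μ (sym (⊆-sum-≡⇒≡ poss μ⊆lam size)))

∑-f^-δ : ∀ {m μ} → μ ⊢ m → (g : List ℕ → ℕ) → ∑[ lam ← partitionsOf m ] (f^ lam μ * g lam) ≡ g μ
∑-f^-δ {m} {μ} μ⊢m@(_ , sizeμ) g =
  trans (∑-congᴬ (All.map (λ ((_ , poss) , size) → cong (_* g _) (f^-same-size poss (trans sizeμ (sym size))))
                          (partitionsOf-sound m)))
        (∑-δ-enum (partitionsOf m) (partitionsOf-enumerates m) g μ⊢m)

∑-f^-same-size : ∀ {k α} → α ⊢ k → ∑[ μ ← partitionsOf k ] f^ α μ ≡ 1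
∑-f^-same-size {k} {α} α⊢k@((_ , poss) , sizeα) =
  trans (∑-congᴬ (All.map (λ (_ , size) → trans (f^-same-size poss (trans size (sym sizeα))) (δ-sym α _))
                          (partitionsOf-sound k)))
        (partitionsOf-enumerates k α⊢k)

downPaths : ℕ → List ℕ → ℕ
downPaths zero _ = 1
downPaths (suc j) lam = ∑ (lowerCovers lam) (downPaths j)

downPaths-vanish : ∀ {B lam} j → Partition≤ B lam → sum lam < j → downPaths j lam ≡ 0
downPaths-vanish {lam = []} (suc j) _ _ = refl
downPaths-vanish {lam = _ ∷ _} (suc j) p (s≤s size≤j) =
  ∑-zeroᴬ (All.map (λ (p′ , size′) → downPaths-vanish j p′ (subst (_≤ j) (sym size′) size≤j))
                   (lowerCovers-shape p))

downPaths≡∑f^ : ∀ {k α} j → α ⊢ k → j ≤ k → downPaths j α ≡ ∑[ μ ← partitionsOf (k ∸ j) ] f^ α μ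
downPaths≡∑f^ zero α⊢k _ = sym (∑-f^-same-size α⊢k)
downPaths≡∑f^ {suc k} {α} (suc j) α⊢k@(isPart , sizeα) (s≤s j≤k) = begin
  ∑[ ρ ← lowerCovers α ] downPaths j ρ
    ≡⟨ ∑-congᴬ (All.map (λ ρ⊢k → downPaths≡∑f^ j ρ⊢k j≤k) (lowerCovers-⊢ α⊢k)) ⟩
  ∑[ ρ ← lowerCovers α ] ∑[ μ ← Pₖ₋ⱼ ] f^ ρ μ
    ≡⟨ ∑-swap (lowerCovers α) Pₖ₋ⱼ f^ ⟩
  ∑[ μ ← Pₖ₋ⱼ ] ∑[ ρ ← lowerCovers α ] f^ ρ μ
    ≡⟨ sym (∑-congᴬ (All.map (λ (_ , sizeμ) → f^-step isPart (λ { refl → smaller sizeμ }))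
                             (partitionsOf-sound (k ∸ j)))) ⟩
  ∑[ μ ← Pₖ₋ⱼ ] f^ α μ ∎
  where
  open ≡-Reasoning
  Pₖ₋ⱼ = partitionsOf (k ∸ j)
  smaller : sum α ≢ k ∸ j
  smaller size = <⇒≱ (s≤s (m∸n≤m k j)) (≤-reflexive (trans (sym sizeα) size))

up : (List ℕ → ℕ) → List ℕ → ℕ
up g lam = ∑ (upperCovers lam) g

up^ : ℕ → (List ℕ → ℕ) → List ℕ → ℕ
up^ zero g = g
up^ (suc n) g = up^ n (up g)

up^-suc : ∀ n g lam → up^ (suc n) g lam ≡ up (up^ n g) lam
up^-suc zero g lam = refl
up^-suc (suc n) g lam = up^-suc n (up g) lam

∑-f^≡up^ : ∀ {m μ} n → μ ⊢ m → (g : List ℕ → ℕ) →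
           ∑[ lam ← partitionsOf (m + n) ] (f^ lam μ * g lam) ≡ up^ n g μ
∑-f^≡up^ {m} zero μ⊢m g rewrite +-identityʳ m = ∑-f^-δ μ⊢m g
∑-f^≡up^ {m} {μ} (suc n) μ⊢m@(_ , sizeμ) g rewrite +-suc m n = begin
  ∑[ lam ← P₁ ] (f^ lam μ * g lam)
    ≡⟨ ∑-congᴬ (All.map (λ (isPart , size) → cong (_* g _) (f^-step isPart (λ { refl → larger size })))
                        (partitionsOf-sound (suc (m + n)))) ⟩
  ∑[ lam ← P₁ ] (∑[ ρ ← lowerCovers lam ] f^ ρ μ * g lam)
    ≡⟨ ∑-cong (λ lam → sym (∑-*ʳ (g lam) (lowerCovers lam) (λ ρ → f^ ρ μ))) P₁ ⟩
  ∑[ lam ← P₁ ] ∑[ ρ ← lowerCovers lam ] (f^ ρ μ * g lam)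
    ≡⟨ ∑-lowerCovers-exchange (m + n) (λ ρ lam → f^ ρ μ * g lam) ⟩
  ∑[ ρ ← partitionsOf (m + n) ] ∑[ lam ← upperCovers ρ ] (f^ ρ μ * g lam)
    ≡⟨ ∑-cong (λ ρ → ∑-*ˡ (f^ ρ μ) (upperCovers ρ) g) (partitionsOf (m + n)) ⟩
  ∑[ ρ ← partitionsOf (m + n) ] (f^ ρ μ * up g ρ)
    ≡⟨ ∑-f^≡up^ n μ⊢m (up g) ⟩
  up^ n (up g) μ ∎
  where
  open ≡-Reasoning
  P₁ = partitionsOf (suc (m + n))
  larger : sum μ ≢ suc (m + n)
  larger size = <⇒≱ (s≤s (m≤m+n m n)) (≤-reflexive (trans (sym size) sizeμ))

up-downPaths : ∀ j {lam} → IsPartition lam →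
               up (downPaths j) lam ≡ downPaths (suc j) lam + downPaths j lam + j * downPaths (pred j) lam
up-downPaths zero {lam} _ =
  trans (#upperCovers≤ (suc (largestPart lam)) lam)
        (trans (cong (∑[ ρ ← lowerCovers lam ] 1 +_) (cong 𝟙 (<ᵇ-true (n<1+n (largestPart lam)))))
               (sym (+-identityʳ _)))
up-downPaths (suc j) {lam} isPart = begin
  up (downPaths (suc j)) lam
    ≡⟨ ∑-upperCovers≤-lowerCovers (downPaths j) (Partition≤-weaken (n≤1+n _) (isPartition⇒Partition≤ isPart)) ⟩
  (if largestPart lam <ᵇ suc (largestPart lam) then Dⱼ lam else 0)
    + ∑[ σ ← lowerCovers lam ] ∑ (upperCovers≤ (suc (largestPart lam)) σ) Dⱼ
    ≡⟨ cong₂ _+_ (if-cong (<ᵇ-true (n<1+n (largestPart lam))))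
                 (∑-congᴬ (All.map step (lowerCovers-shape (isPartition⇒Partition≤ isPart)))) ⟩
  Dⱼ lam + ∑[ σ ← lowerCovers lam ] (Dⱼ₊₁ σ + Dⱼ σ + j * downPaths (pred j) σ)
    ≡⟨ cong (Dⱼ lam +_) (trans (∑-+ (lowerCovers lam) _ _)
                               (cong₂ _+_ (∑-+ (lowerCovers lam) Dⱼ₊₁ Dⱼ)
                                          (∑-*ˡ j (lowerCovers lam) (downPaths (pred j))))) ⟩
  Dⱼ lam + (Dⱼ₊₂ lam + Dⱼ₊₁ lam + j * ∑ (lowerCovers lam) (downPaths (pred j)))
    ≡⟨ cong (λ n → Dⱼ lam + (Dⱼ₊₂ lam + Dⱼ₊₁ lam + n)) (lower-pred j) ⟩
  Dⱼ lam + (Dⱼ₊₂ lam + Dⱼ₊₁ lam + j * Dⱼ lam)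
    ≡⟨ solve 4 (λ x y z w → x :+ (y :+ z :+ w :* x) := y :+ z :+ (con 1 :+ w) :* x) refl
               (Dⱼ lam) (Dⱼ₊₂ lam) (Dⱼ₊₁ lam) j ⟩
  Dⱼ₊₂ lam + Dⱼ₊₁ lam + suc j * Dⱼ lam ∎
  where
  open ≡-Reasoning
  Dⱼ Dⱼ₊₁ Dⱼ₊₂ : List ℕ → ℕ
  Dⱼ = downPaths j
  Dⱼ₊₁ = downPaths (suc j)
  Dⱼ₊₂ = downPaths (suc (suc j))
  step : ∀ {σ} → Partition≤ (largestPart lam) σ × suc (sum σ) ≡ sum lam →
         ∑ (upperCovers≤ (suc (largestPart lam)) σ) Dⱼ ≡ Dⱼ₊₁ σ + Dⱼ σ + j * downPaths (pred j) σ
  step {σ} (p , _) = trans (cong (λ νs → ∑ νs Dⱼ) (upperCovers≤≡upperCovers σ (s≤s (largestPart≤ p))))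
                           (up-downPaths j (Partition≤⇒isPartition p))
  lower-pred : ∀ i → i * ∑ (lowerCovers lam) (downPaths (pred i)) ≡ i * downPaths i lam
  lower-pred zero = refl
  lower-pred (suc i) = refl

-- Involutions

lookup-ext : ∀ {A : Set} {n} {u v : Vec A n} → (∀ i → lookup u i ≡ lookup v i) → u ≡ v
lookup-ext {u = u} {v} eq =
  trans (sym (Vec.tabulate∘lookup u)) (trans (Vec.tabulate-cong eq) (Vec.tabulate∘lookup v))

module _ {n : ℕ} {A : Set} (v : Vec A n) {x y : Fin n} (x≢y : x ≢ y) (a b : A) where

  lookup-update₂-x : lookup ((v [ x ]≔ a) [ y ]≔ b) x ≡ a
  lookup-update₂-x = trans (Vec.lookup∘update′ x≢y (v [ x ]≔ a) b) (Vec.lookup∘update x v a)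

  lookup-update₂-y : lookup ((v [ x ]≔ a) [ y ]≔ b) y ≡ b
  lookup-update₂-y = Vec.lookup∘update y (v [ x ]≔ a) b

  lookup-update₂-other : ∀ {i} → i ≢ x → i ≢ y → lookup ((v [ x ]≔ a) [ y ]≔ b) i ≡ lookup v i
  lookup-update₂-other i≢x i≢y =
    trans (Vec.lookup∘update′ i≢y (v [ x ]≔ a) b) (Vec.lookup∘update′ i≢x v a)

data PairView {n} (x y : Fin n) : Fin n → Set where
  at-x : PairView x y x
  at-y : PairView x y y
  elsewhere : ∀ {i} → i ≢ x → i ≢ y → PairView x y i

pairView : ∀ {n} (x y i : Fin n) → PairView x y i
pairView x y i with i Fin.≟ x | i Fin.≟ y
... | yes refl | _ = at-x
... | no _ | yes refl = at-y
... | no i≢x | no i≢y = elsewhere i≢x i≢y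

module Fin-Counting {n : ℕ} = Counting (Fin._≟_ {n})
module Vec-Counting {k n : ℕ} = Counting (Vec.≡-dec {n = k} (Fin._≟_ {n}))

δᶠ : ∀ {n} → Fin n → Fin n → ℕ
δᶠ = Fin-Counting.δ

δⱽ : ∀ {k n} → Vec (Fin n) k → Vec (Fin n) k → ℕ
δⱽ = Vec-Counting.δ

allFin-enumerates : ∀ n → Fin-Counting.Enumerates (allFin n) (λ _ → ⊤)
allFin-enumerates (suc n) {x} _ = begin
  ∑[ i ← allFin (suc n) ] δᶠ i x
    ≡⟨ cong (λ is → δᶠ zero x + ∑[ i ← is ] δᶠ i x) (sym (map-tabulate id suc)) ⟩
  δᶠ zero x + ∑[ i ← map suc (allFin n) ] δᶠ i x
    ≡⟨ cong (δᶠ zero x +_) (∑-map suc (allFin n) (λ i → δᶠ i x)) ⟩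
  δᶠ zero x + ∑[ i ← allFin n ] δᶠ (suc i) x
    ≡⟨ shifted x ⟩
  1 ∎
  where
  open ≡-Reasoning
  shifted : ∀ x → δᶠ zero x + ∑[ i ← allFin n ] δᶠ (suc i) x ≡ 1
  shifted zero = cong suc (∑-zero (allFin n))
  shifted (suc x) = allFin-enumerates n tt

allMaps-enumerates : ∀ k m → Vec-Counting.Enumerates (allMaps k m) (λ _ → ⊤)
allMaps-enumerates zero m {[]ᵛ} _ = refl
allMaps-enumerates (suc k) m {x ∷ᵛ v} _ = begin
  ∑[ w ← allMaps (suc k) m ] δⱽ w (x ∷ᵛ v)
    ≡⟨ ∑-concatMap (λ i → map (i ∷ᵛ_) (allMaps k m)) (allFin m) (λ w → δⱽ w (x ∷ᵛ v)) ⟩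
  ∑[ i ← allFin m ] ∑[ w ← map (i ∷ᵛ_) (allMaps k m) ] δⱽ w (x ∷ᵛ v)
    ≡⟨ ∑-cong (λ i → trans (∑-map (i ∷ᵛ_) (allMaps k m) (λ w → δⱽ w (x ∷ᵛ v)))
                           (trans (∑-cong (λ w → 𝟙-∧ (does (i Fin.≟ x)) (does (Vec.≡-dec Fin._≟_ w v)))
                                          (allMaps k m))
                                  (∑-*ˡ (δᶠ i x) (allMaps k m) (λ w → δⱽ w v))))
              (allFin m) ⟩
  ∑[ i ← allFin m ] (δᶠ i x * ∑[ w ← allMaps k m ] δⱽ w v)
    ≡⟨ Fin-Counting.∑-δ-enum (allFin m) (allFin-enumerates m) (λ _ → ∑[ w ← allMaps k m ] δⱽ w v) tt ⟩
  ∑[ w ← allMaps k m ] δⱽ w v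
    ≡⟨ allMaps-enumerates k m tt ⟩
  1 ∎
  where open ≡-Reasoning

telephone : ℕ → ℕ
telephone zero = 1
telephone (suc zero) = 1
telephone (suc (suc s)) = telephone (suc s) + suc s * telephone s

telephone-suc : ∀ s → telephone (suc s) ≡ telephone s + s * telephone (pred s)
telephone-suc zero = refl
telephone-suc (suc s) = refl

involution-swap : ∀ {m} {v : Vec (Fin m) m} → isInvolution v → ∀ {i j} → lookup v i ≡ j → lookup v j ≡ i
involution-swap inv {i} refl = inv i

module Involutions (m : ℕ) where

  Endo : Set
  Endo = Vec (Fin m) m

  Subset : Set
  Subset = Fin m → Bool

  FixesOutside : Subset → Endo → Set
  FixesOutside S v = ∀ i → S i ≡ false → lookup v i ≡ i

  InvolutionOn : Subset → Endo → Set
  InvolutionOn S v = isInvolution v × FixesOutside S v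

  involutionOn? : ∀ S v → Dec (InvolutionOn S v)
  involutionOn? S v = Fin.all? (λ i → lookup v (lookup v i) Fin.≟ i)
                      ×-dec Fin.all? (λ i → (S i Bool.≟ false) →-dec (lookup v i Fin.≟ i))

  χ : Subset → Endo → ℕ
  χ S v = 𝟙 (does (involutionOn? S v))

  #involutionsOn : Subset → ℕ
  #involutionsOn S = ∑ (allMaps m m) (χ S)

  ∣_∣ : Subset → ℕ
  ∣ S ∣ = ∑[ i ← allFin m ] 𝟙 (S i)

  _∖_ : Subset → Fin m → Subset
  (S ∖ x) i = S i ∧ not (does (i Fin.≟ x))

  ∖-self : ∀ S x → (S ∖ x) x ≡ false
  ∖-self S x = trans (cong (λ b → S x ∧ not b) (dec-true (x Fin.≟ x) refl)) (Bool.∧-zeroʳ (S x))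

  ∖-other : ∀ S {x i} → i ≢ x → (S ∖ x) i ≡ S i
  ∖-other S {x} {i} i≢x =
    trans (cong (λ b → S i ∧ not b) (dec-false (i Fin.≟ x) i≢x)) (Bool.∧-identityʳ (S i))

  ∖-outside : ∀ S x {i} → S i ≡ false → (S ∖ x) i ≡ false
  ∖-outside S x Si≡false rewrite Si≡false = refl

  size-∖ : ∀ S {x} → S x ≡ true → suc ∣ S ∖ x ∣ ≡ ∣ S ∣
  size-∖ S {x} Sx = begin
    suc ∣ S ∖ x ∣                                  ≡⟨ +-comm 1 ∣ S ∖ x ∣ ⟩
    ∣ S ∖ x ∣ + 1                                  ≡⟨ cong (∣ S ∖ x ∣ +_) (sym (allFin-enumerates m tt)) ⟩
    ∣ S ∖ x ∣ + ∑[ i ← allFin m ] δᶠ i x           ≡⟨ sym (∑-+ (allFin m) _ _) ⟩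
    ∑[ i ← allFin m ] (𝟙 ((S ∖ x) i) + δᶠ i x)     ≡⟨ ∑-cong split (allFin m) ⟩
    ∣ S ∣                                          ∎
    where
    open ≡-Reasoning
    split : ∀ i → 𝟙 ((S ∖ x) i) + δᶠ i x ≡ 𝟙 (S i)
    split i with i Fin.≟ x
    ... | yes refl rewrite Sx = refl
    ... | no _ = trans (+-identityʳ _) (cong 𝟙 (Bool.∧-identityʳ (S i)))

  size≡0⇒empty : ∀ S → ∣ S ∣ ≡ 0 → ∀ i → S i ≡ false
  size≡0⇒empty S size i with S i in Si
  ... | false = refl
  ... | true = contradiction (trans (size-∖ S Si) size) λ ()

  size≡suc⇒nonempty : ∀ S {s} → ∣ S ∣ ≡ suc s → ∃ λ x → S x ≡ true
  size≡suc⇒nonempty S size with Fin.any? (λ i → S i Bool.≟ true)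
  ... | yes found = found
  ... | no none = contradiction (trans (sym size) (∑-zeroᴬ (all-false (allFin m)))) λ ()
    where
    all-false : ∀ is → All (λ i → 𝟙 (S i) ≡ 0) is
    all-false [] = []
    all-false (i ∷ is) with S i in Si
    ... | false = cong 𝟙 Si ∷ all-false is
    ... | true = ⊥-elim (none (i , Si))

  χ-fixing : ∀ S x v → δᶠ x (lookup v x) * χ S v ≡ χ (S ∖ x) v
  χ-fixing S x v =
    trans (𝟙-× (x Fin.≟ lookup v x) (involutionOn? S v))
          (𝟙-⇔ (mk⇔ to from) ((x Fin.≟ lookup v x) ×-dec involutionOn? S v) (involutionOn? (S ∖ x) v))
    where
    to : x ≡ lookup v x × InvolutionOn S v → InvolutionOn (S ∖ x) v
    to (x-fixed , inv , fixes) = inv , fixes′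
      where
      fixes′ : FixesOutside (S ∖ x) v
      fixes′ i S∖x-i with i Fin.≟ x
      ... | yes refl = sym x-fixed
      ... | no _ = fixes i (trans (sym (Bool.∧-identityʳ (S i))) S∖x-i)
    from : InvolutionOn (S ∖ x) v → x ≡ lookup v x × InvolutionOn S v
    from (inv , fixes) = sym (fixes x (∖-self S x)) , inv , λ i Si → fixes i (∖-outside S x Si)

  χ-outside : ∀ S {x y} v → y ≢ x → S y ≡ false → δᶠ y (lookup v x) * χ S v ≡ 0
  χ-outside S {x} {y} v y≢x Sy =
    trans (𝟙-× (y Fin.≟ lookup v x) (involutionOn? S v))
          (𝟙-no ((y Fin.≟ lookup v x) ×-dec involutionOn? S v) impossible)
    where
    impossible : ¬ (y ≡ lookup v x × InvolutionOn S v)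
    impossible (y≡vx , inv , fixes) = y≢x (trans (sym (fixes y Sy)) (involution-swap {v = v} inv (sym y≡vx)))

  -- Involutions on S sending x to y ≠ x correspond to involutions on S ∖ x ∖ y:
  -- fix x and y, or conversely swap them back.
  module Pair (S : Subset) {x y : Fin m} (x≢y : x ≢ y) (Sx : S x ≡ true) (Sy : S y ≡ true) where

    S′ : Subset
    S′ = (S ∖ x) ∖ y

    S′-other : ∀ {i} → i ≢ x → i ≢ y → S′ i ≡ S i
    S′-other i≢x i≢y = trans (∖-other (S ∖ x) i≢y) (∖-other S i≢x)

    S′-x : S′ x ≡ false
    S′-x = ∖-outside (S ∖ x) y (∖-self S x)

    S′-y : S′ y ≡ false
    S′-y = ∖-self (S ∖ x) y

    fixPair swapPair : Endo → Endo
    fixPair v = (v [ x ]≔ x) [ y ]≔ y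
    swapPair w = (w [ x ]≔ y) [ y ]≔ x

    fixPair-involutionOn : ∀ {v} → lookup v x ≡ y → InvolutionOn S v → InvolutionOn S′ (fixPair v)
    fixPair-involutionOn {v} vx≡y (inv , fixes) = inv′ , fixes′
      where
      W = lookup (fixPair v)
      Wx : W x ≡ x
      Wx = lookup-update₂-x v x≢y x y
      Wy : W y ≡ y
      Wy = lookup-update₂-y v x≢y x y
      W-other : ∀ {i} → i ≢ x → i ≢ y → W i ≡ lookup v i
      W-other = lookup-update₂-other v x≢y x y
      vy≡x : lookup v y ≡ x
      vy≡x = involution-swap {v = v} inv vx≡y
      inv′ : isInvolution (fixPair v)
      inv′ i with pairView x y i
      ... | at-x = trans (cong W Wx) Wx
      ... | at-y = trans (cong W Wy) Wy
      ... | elsewhere i≢x i≢y = trans (cong W (W-other i≢x i≢y)) (trans (W-other vi≢x vi≢y) (inv i))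
        where
        vi≢x : lookup v i ≢ x
        vi≢x vi≡x = i≢y (trans (sym (involution-swap {v = v} inv vi≡x)) vx≡y)
        vi≢y : lookup v i ≢ y
        vi≢y vi≡y = i≢x (trans (sym (involution-swap {v = v} inv vi≡y)) vy≡x)
      fixes′ : FixesOutside S′ (fixPair v)
      fixes′ i S′i with pairView x y i
      ... | at-x = Wx
      ... | at-y = Wy
      ... | elsewhere i≢x i≢y = trans (W-other i≢x i≢y) (fixes i (trans (sym (S′-other i≢x i≢y)) S′i))

    swapPair-involutionOn : ∀ {w} → InvolutionOn S′ w → InvolutionOn S (swapPair w)
    swapPair-involutionOn {w} (inv , fixes) = inv′ , fixes′
      where
      V = lookup (swapPair w)
      Vx : V x ≡ y
      Vx = lookup-update₂-x w x≢y y x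
      Vy : V y ≡ x
      Vy = lookup-update₂-y w x≢y y x
      V-other : ∀ {i} → i ≢ x → i ≢ y → V i ≡ lookup w i
      V-other = lookup-update₂-other w x≢y y x
      inv′ : isInvolution (swapPair w)
      inv′ i with pairView x y i
      ... | at-x = trans (cong V Vx) Vy
      ... | at-y = trans (cong V Vy) Vx
      ... | elsewhere i≢x i≢y = trans (cong V (V-other i≢x i≢y)) (trans (V-other wi≢x wi≢y) (inv i))
        where
        wi≢x : lookup w i ≢ x
        wi≢x wi≡x = i≢x (trans (sym (involution-swap {v = w} inv wi≡x)) (fixes x S′-x))
        wi≢y : lookup w i ≢ y
        wi≢y wi≡y = i≢y (trans (sym (involution-swap {v = w} inv wi≡y)) (fixes y S′-y))
      fixes′ : FixesOutside S (swapPair w)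
      fixes′ i Si with pairView x y i
      ... | at-x = contradiction (trans (sym Sx) Si) λ ()
      ... | at-y = contradiction (trans (sym Sy) Si) λ ()
      ... | elsewhere i≢x i≢y = trans (V-other i≢x i≢y) (fixes i (trans (S′-other i≢x i≢y) Si))

    swapPair-fixPair : ∀ {v} → lookup v x ≡ y → isInvolution v → swapPair (fixPair v) ≡ v
    swapPair-fixPair {v} vx≡y inv = lookup-ext pointwise
      where
      pointwise : ∀ i → lookup (swapPair (fixPair v)) i ≡ lookup v i
      pointwise i with pairView x y i
      ... | at-x = trans (lookup-update₂-x (fixPair v) x≢y y x) (sym vx≡y)
      ... | at-y = trans (lookup-update₂-y (fixPair v) x≢y y x) (sym (involution-swap {v = v} inv vx≡y))
      ... | elsewhere i≢x i≢y =
        trans (lookup-update₂-other (fixPair v) x≢y y x i≢x i≢y) (lookup-update₂-other v x≢y x y i≢x i≢y)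

    fixPair-swapPair : ∀ {w} → InvolutionOn S′ w → fixPair (swapPair w) ≡ w
    fixPair-swapPair {w} (_ , fixes) = lookup-ext pointwise
      where
      pointwise : ∀ i → lookup (fixPair (swapPair w)) i ≡ lookup w i
      pointwise i with pairView x y i
      ... | at-x = trans (lookup-update₂-x (swapPair w) x≢y x y) (sym (fixes x S′-x))
      ... | at-y = trans (lookup-update₂-y (swapPair w) x≢y x y) (sym (fixes y S′-y))
      ... | elsewhere i≢x i≢y =
        trans (lookup-update₂-other (swapPair w) x≢y x y i≢x i≢y) (lookup-update₂-other w x≢y y x i≢x i≢y)

    ∑-χ-pair : ∑[ v ← allMaps m m ] (δᶠ y (lookup v x) * χ S v) ≡ #involutionsOn S′
    ∑-χ-pair = Vec-Counting.∑-bijection (allMaps m m) (allMaps-enumerates m m)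
                 (λ v → δᶠ y (lookup v x) * χ S v) (χ S′) fixPair swapPair matching
      where
      matching : ∀ v w → δᶠ y (lookup v x) * χ S v * δⱽ w (fixPair v) ≡ χ S′ w * δⱽ v (swapPair w)
      matching v w = begin
        δᶠ y (lookup v x) * χ S v * δⱽ w (fixPair v)
          ≡⟨ cong (_* δⱽ w (fixPair v)) (𝟙-× y≟vx (involutionOn? S v)) ⟩
        𝟙 (does (y≟vx ×-dec involutionOn? S v)) * δⱽ w (fixPair v)
          ≡⟨ 𝟙-× (y≟vx ×-dec involutionOn? S v) w≟fixPair ⟩
        𝟙 (does ((y≟vx ×-dec involutionOn? S v) ×-dec w≟fixPair))
          ≡⟨ 𝟙-⇔ (mk⇔ to from) ((y≟vx ×-dec involutionOn? S v) ×-dec w≟fixPair)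
                                (involutionOn? S′ w ×-dec v≟swapPair) ⟩
        𝟙 (does (involutionOn? S′ w ×-dec v≟swapPair))
          ≡⟨ sym (𝟙-× (involutionOn? S′ w) v≟swapPair) ⟩
        χ S′ w * δⱽ v (swapPair w) ∎
        where
        open ≡-Reasoning
        y≟vx = y Fin.≟ lookup v x
        w≟fixPair = Vec.≡-dec Fin._≟_ w (fixPair v)
        v≟swapPair = Vec.≡-dec Fin._≟_ v (swapPair w)
        to : (y ≡ lookup v x × InvolutionOn S v) × w ≡ fixPair v → InvolutionOn S′ w × v ≡ swapPair w
        to ((y≡vx , invS) , refl) =
          fixPair-involutionOn {v} (sym y≡vx) invS , sym (swapPair-fixPair {v} (sym y≡vx) (proj₁ invS))
        from : InvolutionOn S′ w × v ≡ swapPair w → (y ≡ lookup v x × InvolutionOn S v) × w ≡ fixPair v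
        from (invS′ , refl) =
          (sym (lookup-update₂-x w x≢y y x) , swapPair-involutionOn {w} invS′) , sym (fixPair-swapPair {w} invS′)

  #involutionsOn-decompose : ∀ S {x} → S x ≡ true →
    #involutionsOn S
      ≡ #involutionsOn (S ∖ x) + ∑[ y ← allFin m ] (if (S ∖ x) y then #involutionsOn ((S ∖ x) ∖ y) else 0)
  #involutionsOn-decompose S {x} Sx = begin
    ∑[ v ← allMaps m m ] χ S v
      ≡⟨ ∑-cong (λ v → sym (Fin-Counting.∑-δ-enum (allFin m) (allFin-enumerates m) (λ _ → χ S v) tt))
                (allMaps m m) ⟩
    ∑[ v ← allMaps m m ] ∑[ y ← allFin m ] (δᶠ y (lookup v x) * χ S v)
      ≡⟨ ∑-swap (allMaps m m) (allFin m) _ ⟩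
    ∑[ y ← allFin m ] ∑[ v ← allMaps m m ] (δᶠ y (lookup v x) * χ S v)
      ≡⟨ ∑-cong (λ y → by-image y (y Fin.≟ x)) (allFin m) ⟩
    ∑[ y ← allFin m ] (δᶠ y x * #involutionsOn (S ∖ x) + paired y)
      ≡⟨ ∑-+ (allFin m) _ paired ⟩
    ∑[ y ← allFin m ] (δᶠ y x * #involutionsOn (S ∖ x)) + ∑ (allFin m) paired
      ≡⟨ cong (_+ ∑ (allFin m) paired)
              (Fin-Counting.∑-δ-enum (allFin m) (allFin-enumerates m) (λ _ → #involutionsOn (S ∖ x)) tt) ⟩
    #involutionsOn (S ∖ x) + ∑ (allFin m) paired ∎
    where
    open ≡-Reasoning
    paired : Fin m → ℕ
    paired y = if (S ∖ x) y then #involutionsOn ((S ∖ x) ∖ y) else 0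
    by-image : ∀ y → Dec (y ≡ x) →
               ∑[ v ← allMaps m m ] (δᶠ y (lookup v x) * χ S v) ≡ δᶠ y x * #involutionsOn (S ∖ x) + paired y
    by-image _ (yes refl) = begin
      ∑[ v ← allMaps m m ] (δᶠ x (lookup v x) * χ S v) ≡⟨ ∑-cong (χ-fixing S x) (allMaps m m) ⟩
      #involutionsOn (S ∖ x)                          ≡⟨ sym (+-identityʳ _) ⟩
      #involutionsOn (S ∖ x) + 0
        ≡⟨ cong₂ _+_ (sym (*-identityˡ _)) (sym (if-cong (∖-self S x))) ⟩
      1 * #involutionsOn (S ∖ x) + paired x
        ≡⟨ cong (λ n → n * #involutionsOn (S ∖ x) + paired x) (sym (Fin-Counting.δ-refl x)) ⟩
      δᶠ x x * #involutionsOn (S ∖ x) + paired x      ∎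
    by-image y (no y≢x) = begin
      ∑[ v ← allMaps m m ] (δᶠ y (lookup v x) * χ S v)  ≡⟨ by-membership (S y) refl ⟩
      (if S y then #involutionsOn ((S ∖ x) ∖ y) else 0) ≡⟨ sym (if-cong (∖-other S y≢x)) ⟩
      paired y
        ≡⟨ cong (λ n → n * #involutionsOn (S ∖ x) + paired y) (sym (𝟙-no (y Fin.≟ x) y≢x)) ⟩
      δᶠ y x * #involutionsOn (S ∖ x) + paired y        ∎
      where
      by-membership : ∀ b → S y ≡ b →
        ∑[ v ← allMaps m m ] (δᶠ y (lookup v x) * χ S v) ≡ (if b then #involutionsOn ((S ∖ x) ∖ y) else 0)
      by-membership true Sy = Pair.∑-χ-pair S (y≢x ∘ sym) Sx Sy
      by-membership false Sy =
        trans (∑-cong (λ v → χ-outside S v y≢x Sy) (allMaps m m)) (∑-zero (allMaps m m))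

  #involutionsOn-empty : ∀ S → ∣ S ∣ ≡ 0 → #involutionsOn S ≡ 1
  #involutionsOn-empty S size =
    trans (∑-cong (λ v → 𝟙-⇔ (mk⇔ to from) (involutionOn? S v) (Vec.≡-dec Fin._≟_ v identity)) (allMaps m m))
          (allMaps-enumerates m m tt)
    where
    identity : Endo
    identity = Data.Vec.tabulate id
    lookup-identity : ∀ i → lookup identity i ≡ i
    lookup-identity = Vec.lookup∘tabulate id
    to : ∀ {v} → InvolutionOn S v → v ≡ identity
    to (_ , fixes) = lookup-ext (λ i → trans (fixes i (size≡0⇒empty S size i)) (sym (lookup-identity i)))
    from : ∀ {v} → v ≡ identity → InvolutionOn S v
    from refl = (λ i → trans (cong (lookup identity) (lookup-identity i)) (lookup-identity i)) ,
                (λ i _ → lookup-identity i)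

  #involutionsOn≡telephone : ∀ s S → ∣ S ∣ ≡ s → #involutionsOn S ≡ telephone s
  #involutionsOn≡telephone zero S size = #involutionsOn-empty S size
  #involutionsOn≡telephone (suc s) S size with size≡suc⇒nonempty S size
  ... | x , Sx = begin
    #involutionsOn S
      ≡⟨ #involutionsOn-decompose S Sx ⟩
    #involutionsOn (S ∖ x) + ∑[ y ← allFin m ] (if (S ∖ x) y then #involutionsOn ((S ∖ x) ∖ y) else 0)
      ≡⟨ cong₂ _+_ (#involutionsOn≡telephone s (S ∖ x) size′) (∑-cong paired (allFin m)) ⟩
    telephone s + ∑[ y ← allFin m ] (telephone (pred s) * 𝟙 ((S ∖ x) y))
      ≡⟨ cong (telephone s +_) (∑-*ˡ (telephone (pred s)) (allFin m) (λ y → 𝟙 ((S ∖ x) y))) ⟩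
    telephone s + telephone (pred s) * ∣ S ∖ x ∣
      ≡⟨ cong (telephone s +_) (trans (cong (telephone (pred s) *_) size′) (*-comm (telephone (pred s)) s)) ⟩
    telephone s + s * telephone (pred s)
      ≡⟨ sym (telephone-suc s) ⟩
    telephone (suc s) ∎
    where
    open ≡-Reasoning
    size′ : ∣ S ∖ x ∣ ≡ s
    size′ = suc-injective (trans (size-∖ S Sx) size)
    paired : ∀ y → (if (S ∖ x) y then #involutionsOn ((S ∖ x) ∖ y) else 0) ≡ telephone (pred s) * 𝟙 ((S ∖ x) y)
    paired y with (S ∖ x) y in S∖x-y
    ... | false = sym (*-zeroʳ (telephone (pred s)))
    ... | true = trans (remaining s (trans (size-∖ (S ∖ x) S∖x-y) size′)) (sym (*-identityʳ (telephone (pred s))))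
      where
      remaining : ∀ s → suc ∣ (S ∖ x) ∖ y ∣ ≡ s → #involutionsOn ((S ∖ x) ∖ y) ≡ telephone (pred s)
      remaining zero ()
      remaining (suc s′) size″ = #involutionsOn≡telephone s′ ((S ∖ x) ∖ y) (suc-injective size″)

  t≡#involutionsOn : t m ≡ #involutionsOn (λ _ → true)
  t≡#involutionsOn =
    trans (∑-length-filter _ (allMaps m m))
          (∑-cong (λ v → 𝟙-⇔ (mk⇔ (λ inv → inv , λ _ ()) proj₁)
                             (Fin.all? (λ i → lookup v (lookup v i) Fin.≟ i)) (involutionOn? (λ _ → true) v))
                  (allMaps m m))

t≡telephone : ∀ m → t m ≡ telephone m
t≡telephone m =
  trans (Involutions.t≡#involutionsOn m)
        (Involutions.#involutionsOn≡telephone m m (λ _ → true) (trans (∑-1≡length (allFin m)) (length-tabulate id)))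

-- Binomial coefficients and the main theorem

[k+1]*nC[k+1]≡[n∸k]*nCk : ∀ n k → suc k * (n C suc k) ≡ (n ∸ k) * (n C k)
[k+1]*nC[k+1]≡[n∸k]*nCk zero zero = refl
[k+1]*nC[k+1]≡[n∸k]*nCk zero (suc k) = *-zeroʳ (suc (suc k))
[k+1]*nC[k+1]≡[n∸k]*nCk (suc n) zero = trans (*-identityˡ _) (trans (nC1≡n (suc n)) (sym (*-identityʳ (suc n))))
[k+1]*nC[k+1]≡[n∸k]*nCk (suc n) (suc k) = begin
  suc (suc k) * (suc n C suc (suc k))
    ≡⟨ cong (suc (suc k) *_) (sym (nCk+nC[k+1]≡[n+1]C[k+1] n (suc k))) ⟩
  suc (suc k) * ((n C suc k) + (n C suc (suc k)))
    ≡⟨ *-distribˡ-+ (suc (suc k)) (n C suc k) _ ⟩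
  suc (suc k) * (n C suc k) + suc (suc k) * (n C suc (suc k))
    ≡⟨ cong (suc (suc k) * (n C suc k) +_) ([k+1]*nC[k+1]≡[n∸k]*nCk n (suc k)) ⟩
  suc (suc k) * (n C suc k) + (n ∸ suc k) * (n C suc k)
    ≡⟨ sym (*-distribʳ-+ (n C suc k) (suc (suc k)) (n ∸ suc k)) ⟩
  (suc (suc k) + (n ∸ suc k)) * (n C suc k)
    ≡⟨ regroup ⟩
  (suc k + (n ∸ k)) * (n C suc k)
    ≡⟨ *-distribʳ-+ (n C suc k) (suc k) (n ∸ k) ⟩
  suc k * (n C suc k) + (n ∸ k) * (n C suc k)
    ≡⟨ cong (_+ (n ∸ k) * (n C suc k)) ([k+1]*nC[k+1]≡[n∸k]*nCk n k) ⟩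
  (n ∸ k) * (n C k) + (n ∸ k) * (n C suc k)
    ≡⟨ sym (*-distribˡ-+ (n ∸ k) (n C k) _) ⟩
  (n ∸ k) * ((n C k) + (n C suc k))
    ≡⟨ cong ((n ∸ k) *_) (nCk+nC[k+1]≡[n+1]C[k+1] n k) ⟩
  (suc n ∸ suc k) * (suc n C suc k) ∎
  where
  open ≡-Reasoning
  regroup : (suc (suc k) + (n ∸ suc k)) * (n C suc k) ≡ (suc k + (n ∸ k)) * (n C suc k)
  regroup with suc k ≤? n
  ... | yes k<n =
    cong (_* (n C suc k)) (trans (sym (+-suc (suc k) (n ∸ suc k))) (cong (suc k +_) (sym (+-∸-assoc 1 k<n))))
  ... | no k≮n rewrite k>n⇒nCk≡0 (≰⇒> k≮n) =
    trans (*-zeroʳ (suc (suc k) + (n ∸ suc k))) (sym (*-zeroʳ (suc k + (n ∸ k))))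

t-suc : ∀ s → t (suc s) ≡ t s + s * t (pred s)
t-suc s rewrite t≡telephone (suc s) | t≡telephone s | t≡telephone (pred s) = telephone-suc s

coefficient : ℕ → ℕ → ℕ
coefficient n j = (n C j) * t (n ∸ j)

coefficient-vanish : ∀ {n j} → n < j → coefficient n j ≡ 0
coefficient-vanish n<j rewrite k>n⇒nCk≡0 n<j = refl

shift : (ℕ → ℕ) → ℕ → ℕ
shift f zero = 0
shift f (suc j) = f j

nC[j+1]*t[n∸j] : ∀ n j → (n C suc j) * t (n ∸ j) ≡ coefficient n (suc j) + suc (suc j) * coefficient n (suc (suc j))
nC[j+1]*t[n∸j] n j with suc j ≤? n
... | no j+1≰n rewrite k>n⇒nCk≡0 (≰⇒> j+1≰n) | k>n⇒nCk≡0 (m<n⇒m<1+n (≰⇒> j+1≰n)) = sym (*-zeroʳ (suc (suc j)))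
... | yes j<n = begin
  (n C suc j) * t (n ∸ j)
    ≡⟨ cong (λ r → (n C suc j) * t r) (+-∸-assoc 1 j<n) ⟩
  (n C suc j) * t (suc r)
    ≡⟨ cong ((n C suc j) *_) (t-suc r) ⟩
  (n C suc j) * (t r + r * t (pred r))
    ≡⟨ solve 4 (λ c u v w → c :* (u :+ v :* w) := c :* u :+ (v :* c) :* w) refl (n C suc j) (t r) r (t (pred r)) ⟩
  coefficient n (suc j) + (r * (n C suc j)) * t (pred r)
    ≡⟨ cong (λ x → coefficient n (suc j) + x * t (pred r)) (sym ([k+1]*nC[k+1]≡[n∸k]*nCk n (suc j))) ⟩
  coefficient n (suc j) + (suc (suc j) * (n C suc (suc j))) * t (pred r)
    ≡⟨ cong (coefficient n (suc j) +_) (*-assoc (suc (suc j)) (n C suc (suc j)) (t (pred r))) ⟩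
  coefficient n (suc j) + suc (suc j) * ((n C suc (suc j)) * t (pred r))
    ≡⟨ cong (λ x → coefficient n (suc j) + suc (suc j) * ((n C suc (suc j)) * t x)) (pred[m∸n]≡m∸[1+n] n (suc j)) ⟩
  coefficient n (suc j) + suc (suc j) * coefficient n (suc (suc j)) ∎
  where
  open ≡-Reasoning
  r = n ∸ suc j

coefficient-suc : ∀ n j →
  coefficient (suc n) j ≡ shift (coefficient n) j + coefficient n j + suc j * coefficient n (suc j)
coefficient-suc n zero = begin
  1 * t (suc n)                       ≡⟨ *-identityˡ (t (suc n)) ⟩
  t (suc n)                           ≡⟨ t-suc n ⟩
  t n + n * t (pred n)                ≡⟨ cong₂ _+_ (sym (*-identityˡ (t n))) (cong (_* t (pred n)) (sym (nC1≡n n))) ⟩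
  1 * t n + (n C 1) * t (pred n)      ≡⟨ cong (1 * t n +_) (sym (*-identityˡ _)) ⟩
  1 * t n + 1 * ((n C 1) * t (n ∸ 1)) ∎
  where open ≡-Reasoning
coefficient-suc n (suc j) = begin
  (suc n C suc j) * t (n ∸ j)
    ≡⟨ cong (_* t (n ∸ j)) (sym (nCk+nC[k+1]≡[n+1]C[k+1] n j)) ⟩
  ((n C j) + (n C suc j)) * t (n ∸ j)
    ≡⟨ *-distribʳ-+ (t (n ∸ j)) (n C j) (n C suc j) ⟩
  coefficient n j + (n C suc j) * t (n ∸ j)
    ≡⟨ cong (coefficient n j +_) (nC[j+1]*t[n∸j] n j) ⟩
  coefficient n j + (coefficient n (suc j) + suc (suc j) * coefficient n (suc (suc j)))
    ≡⟨ sym (+-assoc (coefficient n j) _ _) ⟩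
  coefficient n j + coefficient n (suc j) + suc (suc j) * coefficient n (suc (suc j)) ∎
  where open ≡-Reasoning

∑-recurrence : ∀ n (f g X : ℕ → ℕ) → (∀ {j} → n < j → f j ≡ 0) →
  (∀ j → g j ≡ shift f j + f j + suc j * f (suc j)) →
  ∑[ j < suc n ] (f j * (X (suc j) + X j + j * X (pred j))) ≡ ∑[ j < suc (suc n) ] (g j * X j)
∑-recurrence n f g X vanish recurrence = begin
  ∑[ j < suc n ] (f j * (X (suc j) + X j + j * X (pred j)))
    ≡⟨ ∑<-cong (suc n) (λ {j} _ → solve 4 (λ a x y z → a :* (x :+ y :+ z) := a :* x :+ a :* y :+ a :* z) refl
                                            (f j) (X (suc j)) (X j) (j * X (pred j))) ⟩
  ∑[ j < suc n ] (f j * X (suc j) + f j * X j + f j * (j * X (pred j)))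
    ≡⟨ trans (∑<-+ (suc n) (λ j → f j * X (suc j) + f j * X j) (λ j → f j * (j * X (pred j))))
             (cong (_+ C) (∑<-+ (suc n) (λ j → f j * X (suc j)) (λ j → f j * X j))) ⟩
  A + B + C
    ≡⟨ cong₂ (λ b c → A + b + c) (sym (∑<-extend (suc n) (suc (suc n)) {λ j → f j * X j} (n≤1+n _)
                                                   (λ {j} n<j → cong (_* X j) (vanish n<j))))
                                 lowered ⟩
  A + ∑[ j < suc (suc n) ] (f j * X j) + ∑[ j < suc (suc n) ] (suc j * f (suc j) * X j)
    ≡⟨ trans (cong (_+ ∑[ j < suc (suc n) ] (suc j * f (suc j) * X j))
                   (sym (∑<-+ (suc (suc n)) (λ j → shift f j * X j) (λ j → f j * X j))))
             (sym (∑<-+ (suc (suc n)) (λ j → shift f j * X j + f j * X j) (λ j → suc j * f (suc j) * X j))) ⟩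
  ∑[ j < suc (suc n) ] (shift f j * X j + f j * X j + suc j * f (suc j) * X j)
    ≡⟨ ∑<-cong (suc (suc n)) (λ {j} _ → trans (solve 4 (λ a b c x → a :* x :+ b :* x :+ c :* x := (a :+ b :+ c) :* x)
                                                        refl (shift f j) (f j) (suc j * f (suc j)) (X j))
                                               (cong (_* X j) (sym (recurrence j)))) ⟩
  ∑[ j < suc (suc n) ] (g j * X j) ∎
  where
  open ≡-Reasoning
  A B C : ℕ
  A = ∑[ j < suc n ] (f j * X (suc j))
  B = ∑[ j < suc n ] (f j * X j)
  C = ∑[ j < suc n ] (f j * (j * X (pred j)))
  lowered : C ≡ ∑[ j < suc (suc n) ] (suc j * f (suc j) * X j)
  lowered = begin
    f 0 * 0 + ∑[ j < n ] (f (suc j) * (suc j * X j))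
      ≡⟨ cong (_+ ∑[ j < n ] (f (suc j) * (suc j * X j))) (*-zeroʳ (f 0)) ⟩
    ∑[ j < n ] (f (suc j) * (suc j * X j))
      ≡⟨ ∑<-cong n (λ {j} _ → solve 3 (λ a b x → a :* (b :* x) := b :* a :* x) refl (f (suc j)) (suc j) (X j)) ⟩
    ∑[ j < n ] (suc j * f (suc j) * X j)
      ≡⟨ sym (∑<-extend n (suc (suc n)) (≤-trans (n≤1+n n) (n≤1+n _))
                        (λ {j} n≤j → trans (cong (λ x → suc j * x * X j) (vanish (s≤s n≤j)))
                                           (cong (_* X j) (*-zeroʳ (suc j))))) ⟩
    ∑[ j < suc (suc n) ] (suc j * f (suc j) * X j) ∎

up^-expansion : ∀ n {lam} → IsPartition lam → up^ n (λ _ → 1) lam ≡ ∑[ j < suc n ] (coefficient n j * downPaths j lam)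
up^-expansion zero _ = refl
up^-expansion (suc n) {lam} isPart = begin
  up^ (suc n) (λ _ → 1) lam
    ≡⟨ up^-suc n (λ _ → 1) lam ⟩
  ∑[ ν ← upperCovers lam ] up^ n (λ _ → 1) ν
    ≡⟨ ∑-congᴬ (All.map (λ (p , _) → up^-expansion n (Partition≤⇒isPartition p)) (upperCovers-shape isPart)) ⟩
  ∑[ ν ← upperCovers lam ] ∑[ j < suc n ] (coefficient n j * downPaths j ν)
    ≡⟨ ∑-∑< (upperCovers lam) (suc n) (λ ν j → coefficient n j * downPaths j ν) ⟩
  ∑[ j < suc n ] ∑[ ν ← upperCovers lam ] (coefficient n j * downPaths j ν)
    ≡⟨ ∑<-cong (suc n) (λ {j} _ → trans (∑-*ˡ (coefficient n j) (upperCovers lam) (downPaths j))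
                                         (cong (coefficient n j *_) (up-downPaths j isPart))) ⟩
  ∑[ j < suc n ] (coefficient n j * (downPaths (suc j) lam + downPaths j lam + j * downPaths (pred j) lam))
    ≡⟨ ∑-recurrence n (coefficient n) (coefficient (suc n)) (λ j → downPaths j lam)
                    coefficient-vanish (coefficient-suc n) ⟩
  ∑[ j < suc (suc n) ] (coefficient (suc n) j * downPaths j lam) ∎
  where open ≡-Reasoning

N≡up^ : ∀ {k α} n → α ⊢ k → N (n + k) α ≡ up^ n (λ _ → 1) α
N≡up^ {k} {α} n α⊢k = begin
  ∑[ lam ← partitionsOf (n + k) ] f^ lam α
    ≡⟨ cong (λ m → ∑[ lam ← partitionsOf m ] f^ lam α) (+-comm n k) ⟩
  ∑[ lam ← partitionsOf (k + n) ] f^ lam α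
    ≡⟨ ∑-cong (λ lam → sym (*-identityʳ (f^ lam α))) (partitionsOf (k + n)) ⟩
  ∑[ lam ← partitionsOf (k + n) ] (f^ lam α * 1)
    ≡⟨ ∑-f^≡up^ n α⊢k (λ _ → 1) ⟩
  up^ n (λ _ → 1) α ∎
  where open ≡-Reasoning

∑-coefficient-downPaths : ∀ {k α} n → α ⊢ k →
  ∑[ j < suc n ] (coefficient n j * downPaths j α)
    ≡ ∑[ j < suc k ] ((n C j) * ∑[ μ ← partitionsOf (k ∸ j) ] f^ α μ * t (n ∸ j))
∑-coefficient-downPaths {k} {α} n α⊢k@(isPart , size) = begin
  ∑[ j < suc n ] (coefficient n j * downPaths j α)
    ≡⟨ ∑<-resize (suc n) (suc k) (λ {j} n<j → cong (_* downPaths j α) (coefficient-vanish n<j)) downPaths-beyond ⟩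
  ∑[ j < suc k ] (coefficient n j * downPaths j α)
    ≡⟨ ∑<-cong (suc k) (λ {j} j<1+k → trans (cong (coefficient n j *_) (downPaths≡∑f^ j α⊢k (≤-pred j<1+k)))
                                             (solve 3 (λ c u v → (c :* u) :* v := c :* v :* u) refl
                                                    (n C j) (t (n ∸ j)) (∑[ μ ← partitionsOf (k ∸ j) ] f^ α μ))) ⟩
  ∑[ j < suc k ] ((n C j) * ∑[ μ ← partitionsOf (k ∸ j) ] f^ α μ * t (n ∸ j)) ∎
  where
  open ≡-Reasoning
  downPaths-beyond : ∀ {j} → suc k ≤ j → coefficient n j * downPaths j α ≡ 0
  downPaths-beyond {j} k<j =
    trans (cong (coefficient n j *_)
                (downPaths-vanish j (isPartition⇒Partition≤ isPart) (subst (_< j) (sym size) k<j)))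
          (*-zeroʳ (coefficient n j))

theorem2p2 : (k : ℕ) (α : List ℕ) → IsPartition α → sum α ≡ k →
    (n : ℕ) →
      N (n + k) α
        ≡ sumTo k (λ j → (n C j)
                          * sum (map (λ mu → f^ α mu) (partitionsOf (k ∸ j)))
                          * t (n ∸ j))
theorem2p2 k α isPart size n = begin
  N (n + k) α
    ≡⟨ N≡up^ n (isPart , size) ⟩
  up^ n (λ _ → 1) α
    ≡⟨ up^-expansion n isPart ⟩
  ∑[ j < suc n ] (coefficient n j * downPaths j α)
    ≡⟨ ∑-coefficient-downPaths n (isPart , size) ⟩
  ∑[ j < suc k ] ((n C j) * ∑[ μ ← partitionsOf (k ∸ j) ] f^ α μ * t (n ∸ j))
    ≡⟨ sym (∑-applyUpTo id (suc k) (λ j → (n C j) * ∑[ μ ← partitionsOf (k ∸ j) ] f^ α μ * t (n ∸ j))) ⟩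
  sumTo k (λ j → (n C j) * ∑[ μ ← partitionsOf (k ∸ j) ] f^ α μ * t (n ∸ j)) ∎
  where open ≡-Reasoning
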